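{- Let $\boldsymbol{\phi}=(\phi_i)_{i\ge0}$ and $y$ be indeterminates and work in $\mathbb{Z}[\boldsymbol{\phi},y]$. Define the lower-Hessenberg matrix $P=(p_{ij})_{i,j\ge0}$ by $p_{ij}=0$ if $j=0$ or $j>i+1$, and $p_{ij}=\frac{i!}{(j-1)!}\phi_{i-j+1}$ if $1\le j\le i+1$; and the unit-lower-triangular matrix $B_y$ by $(B_y)_{nk}=\binom{n}{k}y^{n-k}$. Then: (a) $P$ is the production matrix for the generic Lah triangle $\mathsf{L}=(L_{n,k}(\boldsymbol{\phi}))_{n,k\ge0}$, i.e. $L_{n,k}(\boldsymbol{\phi})=(P^n)_{0k}$ for all $n,k\ge0$. (b) $B_y^{ -1}PB_y=P(I+y\Delta^{\mathrm T})$, and this matrix is the production matrix for $\mathsf{L}B_y$, i.e. $(\mathsf{L}B_y)_{nk}=\big((P(I+y\Delta^{\mathrm T}))^n\big)_{0k}$ for all $n,k\ge0$.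
   Context: $\Delta=(\delta_{i+1,j})_{i,j\ge0}$ is the matrix with $1$ on the superdiagonal and $0$ elsewhere, and $I$ is the identity matrix. For a row-finite or column-finite matrix $P$, the output matrix is $\mathcal{O}(P)=((P^n)_{0k})_{n,k\ge0}$, and $P$ is called the production matrix for $A$ if $A=\mathcal{O}(P)$. Generic Lah polynomials: an ordered tree is a rooted tree in which the children of each vertex are linearly ordered; an increasing ordered tree on a finite set of integers is an ordered tree bijectively labeled by that set so that every child has larger label than its parent. $L_{n,k}(\boldsymbol{\phi})$ is the sum over unordered forests of $k$ increasing ordered trees whose vertex sets partition $[n]=\{1,\dots,n\}$ of $\prod_v\phi_{\deg(v)}$, where $\deg(v)$ is the number of children of $v$ ($L_{0,0}=1$, $L_{0,k}=0$ for $k\ge1$, $L_{n,0}=0$ for $n\ge1$). -}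

module Defs where

open import Level using (Level)
open import Data.Nat using (ℕ; zero; suc; _∸_; _<_; _≤?_)
open import Data.Nat.Combinatorics using (_P_; _C_)
open import Data.List using (List; []; _∷_; _++_; length; map; applyUpTo)
open import Data.List.Relation.Unary.All using (All)
open import Data.List.Relation.Unary.Linked using (Linked)
open import Data.List.Relation.Unary.Unique.Propositional using (Unique)
open import Data.List.Relation.Binary.Permutation.Propositional using (_↭_)
open import Data.List.Membership.Propositional using (_∈_)
open import Data.Product using (_×_)
open import Data.Unit using (⊤)
open import Relation.Nullary using (yes; no)
open import Relation.Binary.PropositionalEquality using (_≡_)
open import Function.Bundles using (_⇔_)
open import Algebra.Bundles using (CommutativeRing)

data Tree : Set where
  node : ℕ → List Tree → Tree

root : Tree → ℕ
root (node a _) = a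

mutual
  labels : Tree → List ℕ
  labels (node a ts) = a ∷ labelsF ts

  labelsF : List Tree → List ℕ
  labelsF []       = []
  labelsF (t ∷ ts) = labels t ++ labelsF ts

mutual
  Increasing : Tree → Set
  Increasing (node a ts) = All (λ t → a < root t) ts × IncreasingF ts

  IncreasingF : List Tree → Set
  IncreasingF []       = ⊤
  IncreasingF (t ∷ ts) = Increasing t × IncreasingF ts

[_] : ℕ → List ℕ
[ n ] = applyUpTo suc n

-- An unordered forest is represented canonically by the
-- list of its trees sorted by strictly increasing root labels.
ValidForest : ℕ → ℕ → List Tree → Set
ValidForest n k f =
  IncreasingF f × (labelsF f ↭ [ n ]) × Linked _<_ (map root f) × (length f ≡ k)

IsForestEnum : (ℕ → ℕ → List (List Tree)) → Set
IsForestEnum enum =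
  ∀ n k → Unique (enum n k) × (∀ f → (f ∈ enum n k) ⇔ ValidForest n k f)

module WithRing {c ℓ : Level} (R : CommutativeRing c ℓ) where
  open CommutativeRing R hiding (zero)

  fromℕ : ℕ → Carrier
  fromℕ zero    = 0#
  fromℕ (suc n) = 1# + fromℕ n

  pow : Carrier → ℕ → Carrier
  pow x zero    = 1#
  pow x (suc n) = x * pow x n

  sumTo : ℕ → (ℕ → Carrier) → Carrier
  sumTo zero    f = 0#
  sumTo (suc M) f = sumTo M f + f M

  sumList : List Carrier → Carrier
  sumList []       = 0#
  sumList (x ∷ xs) = x + sumList xs

  module Weights (φ : ℕ → Carrier) where
    mutual
      weight : Tree → Carrier
      weight (node a ts) = φ (length ts) * weightF ts

      weightF : List Tree → Carrier
      weightF []       = 1#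
      weightF (t ∷ ts) = weight t * weightF ts

    Lah : (ℕ → ℕ → List (List Tree)) → ℕ → ℕ → Carrier
    Lah enum n k = sumList (map weightF (enum n k))

  Matrix : Set c
  Matrix = ℕ → ℕ → Carrier

  _≈ᴹ_ : Matrix → Matrix → Set ℓ
  A ≈ᴹ B = ∀ i j → A i j ≈ B i j

  δ : ℕ → ℕ → Carrier
  δ zero    zero    = 1#
  δ zero    (suc j) = 0#
  δ (suc i) zero    = 0#
  δ (suc i) (suc j) = δ i j

  Iᴹ : Matrix
  Iᴹ = δ

  Δ : Matrix
  Δ i j = δ (suc i) j

  _ᵀ : Matrix → Matrix
  (A ᵀ) i j = A j i

  _+ᴹ_ : Matrix → Matrix → Matrix
  (A +ᴹ B) i j = A i j + B i j

  _·ᴹ_ : Carrier → Matrix → Matrix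
  (x ·ᴹ A) i j = x * A i j

  -- Product of infinite matrices whose LEFT factor is lower Hessenberg
  -- (A i k = 0 for k > i+1), so (A B)_{ij} = Σ_{k ≤ i+1} A_{ik} B_{kj}.
  _⊙_ : Matrix → Matrix → Matrix
  (A ⊙ B) i j = sumTo (suc (suc i)) (λ k → A i k * B k j)

  -- Output matrix O(A)_{nk} = (A^n)_{0k} for lower-Hessenberg A:
  -- row 0 of A^n is supported on columns 0..n, so
  -- (A^{n+1})_{0k} = Σ_{i ≤ n} (A^n)_{0i} A_{ik}.
  𝒪 : Matrix → Matrix
  𝒪 A zero    k = δ zero k
  𝒪 A (suc n) k = sumTo (suc n) (λ i → 𝒪 A n i * A i k)

  Pmat : (ℕ → Carrier) → Matrix
  Pmat φ i zero = 0#
  Pmat φ i (suc j) with j ≤? i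
  ... | yes _ = fromℕ (i P (i ∸ j)) * φ (i ∸ j)   -- i!/(j)! · φ_{i-(j+1)+1}
  ... | no  _ = 0#

  Bmat : Carrier → Matrix
  Bmat y n k = fromℕ (n C k) * pow y (n ∸ k)

module Submission where

-- (a) A forest on [n+1] arises uniquely from a forest on [n] with i trees:
-- shift all labels up by one and give a new root 1 an ordered selection of
-- i - j of the trees as its children, keeping the other j trees (module
-- ForestRecursion, built on ordered selections in Arrangements and on label
-- shifting in Forests).  So for any enumeration, the forests on [n+1] with
-- j + 1 trees are these extensions up to order (Enumeration), and weighting
-- them gives L_{n+1,k} = Σ_i L_{n,i} P_{i,k}, i.e. L = O(P) (LahProduction).
--
-- (b) Binomial matrices satisfy B_a B_b = B_{a+b} and B_0 = I, so B_{-y} is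
-- the inverse of B_y (BinomialMatrices).  A falling-factorial identity
-- (FactorialIdentity) gives P B_y = B_y Q for Q = P (I + yΔᵀ)
-- (ProductionMatrix).  General facts about products of lower-Hessenberg
-- matrices (BandedMatrices) turn this into B_y⁻¹ P B_y = Q and
-- O(Q) = O(P) B_y, which by (a) is L B_y.

open import Defs

open import Level using (Level)
open import Data.Bool using (true; false)
open import Data.Nat as Nat using (ℕ; zero; suc; pred; _∸_; _!; _<ᵇ_; _<_; _≤_; _≰_; s≤s; z≤n; _≤?_)
import Data.Nat.Properties as ℕₚ
import Data.Nat.Combinatorics as Combinatorics
open import Data.Nat.Combinatorics.Specification
  using (nP′k≡n[n∸1P′k∸1]; nPk≡n!/[n∸k]!; nCk≡n!/k![n-k]!; [n∸k]!k!∣n!)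
open import Data.Nat.DivMod using (m/n*n≡m)
open import Data.Nat.Divisibility using (_∣_; ∣-trans; m∣m*n)
open import Data.List using (List; []; _∷_; _++_; length; map; concatMap; foldr)
open import Data.List.Properties
  using ( length-++; length-map; length-applyUpTo; map-∘; map-id; map-++; map-applyUpTo; ++-assoc
        ; ∷-injectiveˡ; ∷-injectiveʳ)
open import Data.List.Relation.Unary.All as All using (All; []; _∷_)
import Data.List.Relation.Unary.All.Properties as All
open import Data.List.Relation.Unary.Any using (here; there)
open import Data.List.Relation.Unary.AllPairs using (AllPairs; []; _∷_)
open import Data.List.Relation.Unary.Linked as Linked using (Linked)
import Data.List.Relation.Unary.Linked.Properties as Linked
open import Data.List.Relation.Unary.Unique.Propositional using (Unique)
import Data.List.Relation.Unary.Unique.Propositional.Properties as Unique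
import Data.List.Relation.Binary.Permutation.Propositional as Perm
open import Data.List.Relation.Binary.Permutation.Propositional
  using (_↭_; ↭-refl; ↭-sym; ↭-trans; ↭-prep; ↭-swap; ↭⇒↭ₛ)
open import Data.List.Relation.Binary.Permutation.Propositional.Properties
  using (↭-length; ∈-resp-↭; All-resp-↭; drop-mid; drop-∷; ++⁺ˡ; shifts; map⁺)
open import Data.List.Membership.Propositional using (_∈_; find; lose)
open import Data.List.Membership.Propositional.Properties
  using (∈-map⁺; ∈-map⁻; ∈-concatMap⁺; ∈-concatMap⁻; ∈-∃++; ∈-++⁺ˡ; ∈-++⁺ʳ; ∈-++⁻)
open import Data.List.Membership.Propositional.Properties.WithK using (unique∧set⇒bag)
open import Data.List.Relation.Binary.BagAndSetEquality using (∼bag⇒↭)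
open import Data.Product using (_×_; _,_; proj₁; proj₂; ∃)
open import Data.Unit using (tt)
open import Data.Empty using (⊥-elim)
open import Data.Sum using (inj₁; inj₂)
open import Relation.Nullary using (Dec; yes; no)
open import Function.Bundles using (Equivalence; mk⇔)
open import Relation.Binary.Core using (Rel)
open import Relation.Binary.Definitions using (tri<; tri≈; tri>)
open import Algebra.Bundles using (CommutativeRing)
import Algebra.Solver.Ring.NaturalCoefficients.Default as Solver
open import Relation.Binary.PropositionalEquality
  using (_≡_; _≢_; refl; sym; trans; cong; cong₂; subst; subst₂; module ≡-Reasoning)
import Relation.Binary.PropositionalEquality as ≡

private variable a b : Level

module ListFacts {A : Set a} {B : Set b} where
  open Nat using (_+_; _*_)

  ∈-concatMap-intro : (f : A → List B) {xs : List A} {x : A} {y : B} →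
    x ∈ xs → y ∈ f x → y ∈ concatMap f xs
  ∈-concatMap-intro f x∈ y∈ = ∈-concatMap⁺ f (lose x∈ y∈)

  ∈-concatMap-elim : (f : A → List B) (xs : List A) {y : B} →
    y ∈ concatMap f xs → ∃ λ x → x ∈ xs × y ∈ f x
  ∈-concatMap-elim f xs y∈ = find (∈-concatMap⁻ f y∈)

  concatMap-unique : (f : A → List B) (xs : List A) → Unique xs →
    (∀ {x} → x ∈ xs → Unique (f x)) →
    (∀ {x x' y} → x ∈ xs → x' ∈ xs → y ∈ f x → y ∈ f x' → x ≡ x') →
    Unique (concatMap f xs)
  concatMap-unique f [] _ _ _ = []
  concatMap-unique f (x ∷ xs) (x∉xs ∷ u) uf disjoint =
    Unique.++⁺ (uf (here refl))
      (concatMap-unique f xs u (λ p → uf (there p)) (λ p q → disjoint (there p) (there q)))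
      λ (y∈fx , y∈rest) →
        let (z , z∈ , y∈fz) = ∈-concatMap-elim f xs y∈rest
        in All.lookup x∉xs z∈ (disjoint (here refl) (there z∈) y∈fx y∈fz)

  unique-map-injective : (f : A → B) {xs : List A} → Unique (map f xs) →
    ∀ {x x'} → x ∈ xs → x' ∈ xs → f x ≡ f x' → x ≡ x'
  unique-map-injective f _       (here refl) (here refl) _ = refl
  unique-map-injective f (h ∷ _) (here refl) (there q)   e = ⊥-elim (All.lookup h (∈-map⁺ f q) e)
  unique-map-injective f (h ∷ _) (there p)   (here refl) e = ⊥-elim (All.lookup h (∈-map⁺ f p) (sym e))
  unique-map-injective f (_ ∷ u) (there p)   (there q)   e = unique-map-injective f u p q e

  concatMap-length : (f : A → List B) (xs : List A) (c : ℕ) →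
    (∀ {x} → x ∈ xs → length (f x) ≡ c) → length (concatMap f xs) ≡ length xs * c
  concatMap-length f []       c _ = refl
  concatMap-length f (x ∷ xs) c h =
    trans (length-++ (f x)) (cong₂ _+_ (h (here refl)) (concatMap-length f xs c (λ p → h (there p))))

unique-↭ : {A : Set a} {xs ys : List A} → xs ↭ ys → Unique xs → Unique ys
unique-↭ {A = A} p = Unique-resp-↭ (↭⇒↭ₛ p)
  where open import Data.List.Relation.Binary.Permutation.Setoid.Properties (≡.setoid A) using (Unique-resp-↭)

same-members-↭ : {A : Set a} {xs ys : List A} → Unique xs → Unique ys →
  (∀ {x} → x ∈ xs → x ∈ ys) → (∀ {x} → x ∈ ys → x ∈ xs) → xs ↭ ys
same-members-↭ ux uy to from = ∼bag⇒↭ (unique∧set⇒bag ux uy (mk⇔ to from))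

-- `arrangements d xs` lists every way of choosing an ordered sequence s of d
-- entries of xs, paired with the list r of the remaining entries in their
-- original order.  There are (length xs) P d of them; they are the choices
-- of the ordered children of a new root in the forest recursion.
module Arrangements {A : Set a} where
  open Nat using (_*_)
  open Combinatorics using (_P_)
  open ListFacts

  -- The falling factorial obeys (m+1) P (d+1) = (m+1)(m P d).  By definition
  -- m P d tests d ≤ᵇ m, which for (m+1, d+2) reduces to the test d <ᵇ m.
  P-suc : ∀ m d → suc m P suc d ≡ suc m * (m P d)
  P-suc m zero = refl
  P-suc m (suc d) with d <ᵇ m
  ... | true  = nP′k≡n[n∸1P′k∸1] (suc m) (suc (suc d))
  ... | false = sym (ℕₚ.*-zeroʳ (suc m))

  pickOne : List A → List (A × List A)
  pickOne []       = []
  pickOne (x ∷ xs) = (x , xs) ∷ map (λ (y , ys) → y , x ∷ ys) (pickOne xs)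

  prepend : A → List A × List A → List A × List A
  prepend y (s , r) = y ∷ s , r

  mutual
    arrangements : ℕ → List A → List (List A × List A)
    arrangements zero    xs = ([] , xs) ∷ []
    arrangements (suc d) xs = concatMap (headedBy d) (pickOne xs)

    headedBy : ℕ → A × List A → List (List A × List A)
    headedBy d (y , ys) = map (prepend y) (arrangements d ys)

  pickOne-picked : (xs : List A) → map proj₁ (pickOne xs) ≡ xs
  pickOne-picked []       = refl
  pickOne-picked (x ∷ xs) = cong (x ∷_) (trans (sym (map-∘ (pickOne xs))) (pickOne-picked xs))

  pickOne-↭ : ∀ {xs y ys} → (y , ys) ∈ pickOne xs → y ∷ ys ↭ xs
  pickOne-↭ {x ∷ xs} (here refl) = ↭-refl
  pickOne-↭ {x ∷ xs} (there p) with ∈-map⁻ _ p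
  ... | (z , zs) , q , refl = ↭-trans (↭-swap z x ↭-refl) (↭-prep x (pickOne-↭ q))

  pickOne-All : ∀ {Q : A → Set b} {xs y ys} → (y , ys) ∈ pickOne xs → All Q xs → All Q ys
  pickOne-All {xs = _ ∷ _} (here refl) (_ ∷ ps) = ps
  pickOne-All {xs = _ ∷ _} (there p) (px ∷ ps) with ∈-map⁻ _ p
  ... | _ , q , refl = px ∷ pickOne-All q ps

  pickOne-AllPairs : ∀ {R : Rel A b} {xs y ys} → (y , ys) ∈ pickOne xs → AllPairs R xs → AllPairs R ys
  pickOne-AllPairs {xs = _ ∷ _} (here refl) (_ ∷ rs) = rs
  pickOne-AllPairs {xs = _ ∷ _} (there p) (rx ∷ rs) with ∈-map⁻ _ p
  ... | _ , q , refl = pickOne-All q rx ∷ pickOne-AllPairs q rs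

  pickOne-at : ∀ h₁ {x} h₂ → (x , h₁ ++ h₂) ∈ pickOne (h₁ ++ x ∷ h₂)
  pickOne-at []       h₂ = here refl
  pickOne-at (z ∷ h₁) h₂ = there (∈-map⁺ _ (pickOne-at h₁ h₂))

  pickOne-unique : ∀ {xs} → Unique xs → Unique (pickOne xs)
  pickOne-unique {xs} u = Unique.map⁻ (subst Unique (sym (pickOne-picked xs)) u)

  arrangement-↭ : ∀ d {xs s r} → (s , r) ∈ arrangements d xs → length s ≡ d × s ++ r ↭ xs
  arrangement-↭ zero (here refl) = refl , ↭-refl
  arrangement-↭ (suc d) {xs} m with ∈-concatMap-elim _ (pickOne xs) m
  ... | (y , ys) , y∈ , q∈ with ∈-map⁻ _ q∈
  ... | _ , q , refl with arrangement-↭ d q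
  ... | length-s , s++r↭ = cong suc length-s , ↭-trans (↭-prep y s++r↭) (pickOne-↭ y∈)

  arrangement-AllPairs : ∀ {R : Rel A b} d {xs s r} → (s , r) ∈ arrangements d xs →
    AllPairs R xs → AllPairs R r
  arrangement-AllPairs zero (here refl) rs = rs
  arrangement-AllPairs (suc d) {xs} m rs with ∈-concatMap-elim _ (pickOne xs) m
  ... | _ , y∈ , q∈ with ∈-map⁻ _ q∈
  ... | _ , q , refl = arrangement-AllPairs d q (pickOne-AllPairs y∈ rs)

  arrangements-complete : ∀ {R : Rel A b} →
    (∀ {xs ys} → xs ↭ ys → AllPairs R xs → AllPairs R ys → xs ≡ ys) →
    ∀ s {r xs} → s ++ r ↭ xs → AllPairs R xs → AllPairs R r → (s , r) ∈ arrangements (length s) xs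
  arrangements-complete sorted-unique [] p rxs rr with sorted-unique p rr rxs
  ... | refl = here refl
  arrangements-complete {R = R} sorted-unique (x ∷ s) p rxs rr
    with ∈-∃++ (∈-resp-↭ p (here refl))
  ... | h₁ , h₂ , refl =
    ∈-concatMap-intro (headedBy (length s)) (pickOne-at h₁ h₂)
      (∈-map⁺ (prepend x) (arrangements-complete sorted-unique s (drop-mid [] h₁ p) (AllPairs-remove h₁ rxs) rr))
    where
    All-remove : ∀ {Q : A → Set b} h₁ {y h₂} → All Q (h₁ ++ y ∷ h₂) → All Q (h₁ ++ h₂)
    All-remove []       (_ ∷ ps)  = ps
    All-remove (_ ∷ h₁) (px ∷ ps) = px ∷ All-remove h₁ ps
    AllPairs-remove : ∀ h₁ {y h₂} → AllPairs R (h₁ ++ y ∷ h₂) → AllPairs R (h₁ ++ h₂)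
    AllPairs-remove []       (_ ∷ rs)  = rs
    AllPairs-remove (_ ∷ h₁) (rx ∷ rs) = All-remove h₁ rx ∷ AllPairs-remove h₁ rs

  arrangements-length : ∀ d (xs : List A) → length (arrangements d xs) ≡ length xs P d
  arrangements-length zero    xs = refl
  arrangements-length (suc d) [] = refl
  arrangements-length (suc d) (x ∷ xs) =
    trans (concatMap-length (headedBy d) (pickOne (x ∷ xs)) (length xs P d) each)
          (trans (cong (_* (length xs P d)) pickOne-length) (sym (P-suc (length xs) d)))
    where
    pickOne-length : length (pickOne (x ∷ xs)) ≡ suc (length xs)
    pickOne-length = trans (sym (length-map proj₁ (pickOne (x ∷ xs)))) (cong length (pickOne-picked (x ∷ xs)))
    each : ∀ {p} → p ∈ pickOne (x ∷ xs) → length (headedBy d p) ≡ length xs P d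
    each {y , ys} y∈ = trans (length-map (prepend y) (arrangements d ys))
      (trans (arrangements-length d ys) (cong (λ m → pred m P d) (↭-length (pickOne-↭ y∈))))

  arrangements-unique : ∀ d {xs} → Unique xs → Unique (arrangements d xs)
  arrangements-unique zero    u = [] ∷ []
  arrangements-unique (suc d) {xs} u =
    concatMap-unique (headedBy d) (pickOne xs) (pickOne-unique u)
      (λ {p} p∈ → Unique.map⁺ prepend-injective (arrangements-unique d (rest-unique p∈)))
      λ p∈ p'∈ q∈ q'∈ →
        unique-map-injective proj₁ (subst Unique (sym (pickOne-picked xs)) u) p∈ p'∈ (same-head q∈ q'∈)
    where
    rest-unique : ∀ {y ys} → (y , ys) ∈ pickOne xs → Unique ys
    rest-unique p∈ with unique-↭ (↭-sym (pickOne-↭ p∈)) u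
    ... | _ ∷ u' = u'
    prepend-injective : ∀ {y} {q q' : List A × List A} → prepend y q ≡ prepend y q' → q ≡ q'
    prepend-injective refl = refl
    same-head : ∀ {p p' : A × List A} {q} → q ∈ headedBy d p → q ∈ headedBy d p' → proj₁ p ≡ proj₁ p'
    same-head q∈ q'∈ with ∈-map⁻ _ q∈ | ∈-map⁻ _ q'∈
    ... | _ , _ , refl | _ , _ , refl = refl

-- The recursion for the Lah triangle
-- shifts all labels of a forest on [n] up by one and adds a new vertex 1; the
-- lemmas below say that shifting preserves and reflects everything that
-- ValidForest is made of (labels, increasing trees, sorting by roots), and
-- provide insertion sort by roots to restore the canonical order of a forest.
module Forests where

  children : Tree → List Tree
  children (node _ ts) = ts

  mutual
    shiftTree : Tree → Tree
    shiftTree (node a ts) = node (suc a) (shiftForest ts)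

    shiftForest : List Tree → List Tree
    shiftForest []       = []
    shiftForest (t ∷ ts) = shiftTree t ∷ shiftForest ts

  mutual
    unshiftTree : Tree → Tree
    unshiftTree (node a ts) = node (pred a) (unshiftForest ts)

    unshiftForest : List Tree → List Tree
    unshiftForest []       = []
    unshiftForest (t ∷ ts) = unshiftTree t ∷ unshiftForest ts

  labelsF-++ : ∀ xs ys → labelsF (xs ++ ys) ≡ labelsF xs ++ labelsF ys
  labelsF-++ []       ys = refl
  labelsF-++ (x ∷ xs) ys = trans (cong (labels x ++_) (labelsF-++ xs ys)) (sym (++-assoc (labels x) _ _))

  labelsF-↭ : ∀ {xs ys} → xs ↭ ys → labelsF xs ↭ labelsF ys
  labelsF-↭ Perm.refl          = ↭-refl
  labelsF-↭ (Perm.prep x p)    = ++⁺ˡ (labels x) (labelsF-↭ p)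
  labelsF-↭ (Perm.swap x y p)  =
    ↭-trans (shifts (labels x) (labels y)) (++⁺ˡ (labels y) (++⁺ˡ (labels x) (labelsF-↭ p)))
  labelsF-↭ (Perm.trans p q)   = ↭-trans (labelsF-↭ p) (labelsF-↭ q)

  -- every tree has at least one label
  length≤labels : ∀ ts → length ts ≤ length (labelsF ts)
  length≤labels []               = z≤n
  length≤labels (node a xs ∷ ts) = s≤s (ℕₚ.≤-trans (length≤labels ts) rest≤)
    where
    rest≤ : length (labelsF ts) ≤ length (labelsF xs ++ labelsF ts)
    rest≤ = subst (length (labelsF ts) ≤_) (sym (length-++ (labelsF xs))) (ℕₚ.m≤n+m _ _)

  mutual
    labels-shift : ∀ t → labels (shiftTree t) ≡ map suc (labels t)
    labels-shift (node a ts) = cong (suc a ∷_) (labelsF-shift ts)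

    labelsF-shift : ∀ ts → labelsF (shiftForest ts) ≡ map suc (labelsF ts)
    labelsF-shift []       = refl
    labelsF-shift (t ∷ ts) =
      trans (cong₂ _++_ (labels-shift t) (labelsF-shift ts)) (sym (map-++ suc (labels t) _))

  length-shift : ∀ ts → length (shiftForest ts) ≡ length ts
  length-shift []       = refl
  length-shift (t ∷ ts) = cong suc (length-shift ts)

  mutual
    shiftTree-injective : ∀ {s t} → shiftTree s ≡ shiftTree t → s ≡ t
    shiftTree-injective {node a xs} {node b ys} e =
      cong₂ node (ℕₚ.suc-injective (cong root e)) (shiftForest-injective (cong children e))

    shiftForest-injective : ∀ {xs ys} → shiftForest xs ≡ shiftForest ys → xs ≡ ys
    shiftForest-injective {[]}     {[]}     e    = refl
    shiftForest-injective {x ∷ xs} {y ∷ ys} e =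
      cong₂ _∷_ (shiftTree-injective (∷-injectiveˡ e)) (shiftForest-injective (∷-injectiveʳ e))

  mutual
    shift-unshiftTree : ∀ t → All (1 ≤_) (labels t) → shiftTree (unshiftTree t) ≡ t
    shift-unshiftTree (node (suc a) ts) (_ ∷ pos) = cong (node (suc a)) (shift-unshiftForest ts pos)

    shift-unshiftForest : ∀ ts → All (1 ≤_) (labelsF ts) → shiftForest (unshiftForest ts) ≡ ts
    shift-unshiftForest []       _   = refl
    shift-unshiftForest (t ∷ ts) pos =
      cong₂ _∷_ (shift-unshiftTree t (All.++⁻ˡ (labels t) pos))
                (shift-unshiftForest ts (All.++⁻ʳ (labels t) pos))

  IncreasingF⇒All : ∀ {ts} → IncreasingF ts → All Increasing ts
  IncreasingF⇒All {[]}     _        = []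
  IncreasingF⇒All {t ∷ ts} (i , is) = i ∷ IncreasingF⇒All is

  All⇒IncreasingF : ∀ {ts} → All Increasing ts → IncreasingF ts
  All⇒IncreasingF []       = tt
  All⇒IncreasingF (i ∷ is) = i , All⇒IncreasingF is

  shift-roots> : ∀ {a} ts → All (λ t → a < root t) ts → All (λ t → suc a < root t) (shiftForest ts)
  shift-roots> []               []       = []
  shift-roots> (node b _ ∷ ts) (p ∷ ps) = s≤s p ∷ shift-roots> ts ps

  unshift-roots> : ∀ {a} ts → All (λ t → suc a < root t) (shiftForest ts) → All (λ t → a < root t) ts
  unshift-roots> []               []           = []
  unshift-roots> (node b _ ∷ ts) (s≤s p ∷ ps) = p ∷ unshift-roots> ts ps

  mutual
    Increasing-shift : ∀ t → Increasing t → Increasing (shiftTree t)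
    Increasing-shift (node a ts) (rs , is) = shift-roots> ts rs , IncreasingF-shift ts is

    IncreasingF-shift : ∀ ts → IncreasingF ts → IncreasingF (shiftForest ts)
    IncreasingF-shift []       _        = tt
    IncreasingF-shift (t ∷ ts) (i , is) = Increasing-shift t i , IncreasingF-shift ts is

  mutual
    Increasing-unshift : ∀ t → Increasing (shiftTree t) → Increasing t
    Increasing-unshift (node a ts) (rs , is) = unshift-roots> ts rs , IncreasingF-unshift ts is

    IncreasingF-unshift : ∀ ts → IncreasingF (shiftForest ts) → IncreasingF ts
    IncreasingF-unshift []       _        = tt
    IncreasingF-unshift (t ∷ ts) (i , is) = Increasing-unshift t i , IncreasingF-unshift ts is

  mutual
    root-minimal : ∀ t → Increasing t → All (root t ≤_) (labels t)
    root-minimal (node a ts) (rs , is) = ℕₚ.≤-refl ∷ below-children a ts rs is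

    below-children : ∀ a ts → All (λ t → a < root t) ts → IncreasingF ts → All (a ≤_) (labelsF ts)
    below-children a []       []       _        = []
    below-children a (t ∷ ts) (p ∷ ps) (i , is) =
      All.++⁺ (All.map (ℕₚ.≤-trans (ℕₚ.<⇒≤ p)) (root-minimal t i)) (below-children a ts ps is)

  RootLt : Tree → Tree → Set
  RootLt s t = root s < root t

  Sorted : List Tree → Set
  Sorted = AllPairs RootLt

  Linked⇒Sorted : ∀ {ts} → Linked _<_ (map root ts) → Sorted ts
  Linked⇒Sorted l = Linked.Linked⇒AllPairs ℕₚ.<-trans (Linked.map⁻ l)

  Sorted⇒Linked : ∀ {ts} → Sorted ts → Linked _<_ (map root ts)
  Sorted⇒Linked s = Linked.map⁺ (Linked.AllPairs⇒Linked s)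

  sorted-unique : ∀ {xs ys} → xs ↭ ys → Sorted xs → Sorted ys → xs ≡ ys
  sorted-unique {[]}     {[]}     _ _ _ = refl
  sorted-unique {[]}     {_ ∷ _}  p _ _ with ↭-length p
  ... | ()
  sorted-unique {_ ∷ _}  {[]}     p _ _ with ↭-length p
  ... | ()
  sorted-unique {x ∷ xs} {y ∷ ys} p (x< ∷ sx) (y< ∷ sy)
    with ∈-resp-↭ p (here refl) | ∈-resp-↭ (↭-sym p) (here refl)
  ... | here refl  | _          = cong (x ∷_) (sorted-unique (drop-∷ p) sx sy)
  ... | there _    | here refl  = cong (x ∷_) (sorted-unique (drop-∷ p) sx sy)
  ... | there x∈ys | there y∈xs = ⊥-elim (ℕₚ.<-asym (All.lookup y< x∈ys) (All.lookup x< y∈xs))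

  Sorted-tail : ∀ {t ts} → Sorted (t ∷ ts) → Sorted ts
  Sorted-tail (_ ∷ rs) = rs

  Sorted-head : ∀ {t ts} → Sorted (t ∷ ts) → All (RootLt t) ts
  Sorted-head (r ∷ _) = r

  Sorted⇒Unique : ∀ {ts} → Sorted ts → Unique ts
  Sorted⇒Unique []       = []
  Sorted⇒Unique (r ∷ rs) = All.map (λ lt e → ℕₚ.<-irrefl (cong root e) lt) r ∷ Sorted⇒Unique rs

  Sorted-shift : ∀ {ts} → Sorted ts → Sorted (shiftForest ts)
  Sorted-shift {[]}             []       = []
  Sorted-shift {node _ _ ∷ ts} (r ∷ rs) = shift-roots> ts r ∷ Sorted-shift rs

  Sorted-unshift : ∀ {ts} → Sorted (shiftForest ts) → Sorted ts
  Sorted-unshift {[]}             []       = []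
  Sorted-unshift {node _ _ ∷ ts} (r ∷ rs) = unshift-roots> ts r ∷ Sorted-unshift rs

  roots⊆labels : ∀ {x} ts → x ∈ map root ts → x ∈ labelsF ts
  roots⊆labels (node a xs ∷ ts) (here refl) = here refl
  roots⊆labels (node a xs ∷ ts) (there p)   = ∈-++⁺ʳ (a ∷ labelsF xs) (roots⊆labels ts p)

  roots-unique : ∀ ts → Unique (labelsF ts) → Unique (map root ts)
  roots-unique []               _         = []
  roots-unique (node a xs ∷ ts) (a∉ ∷ u) =
    All.tabulate (λ y∈ → All.lookup a∉ (∈-++⁺ʳ (labelsF xs) (roots⊆labels ts y∈)))
    ∷ roots-unique ts (unique-++⁻ʳ (labelsF xs) u)
    where
    unique-++⁻ʳ : ∀ (xs : List ℕ) {ys} → Unique (xs ++ ys) → Unique ys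
    unique-++⁻ʳ []       u       = u
    unique-++⁻ʳ (_ ∷ xs) (_ ∷ u) = unique-++⁻ʳ xs u

  labelsF-∈ : ∀ {x} ts → x ∈ labelsF ts → ∃ λ u → u ∈ ts × x ∈ labels u
  labelsF-∈ (t ∷ ts) x∈ with ∈-++⁻ (labels t) x∈
  ... | inj₁ p = t , here refl , p
  ... | inj₂ p with labelsF-∈ ts p
  ... | u , u∈ , q = u , there u∈ , q

  -- Insertion sort by root label, used to re-sort the trees left over when
  -- the root 1 is removed.
  insertByRoot : Tree → List Tree → List Tree
  insertByRoot t []       = t ∷ []
  insertByRoot t (u ∷ us) with root t ≤? root u
  ... | yes _ = t ∷ u ∷ us
  ... | no  _ = u ∷ insertByRoot t us

  sortByRoot : List Tree → List Tree
  sortByRoot = foldr insertByRoot []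

  RootLe : Tree → Tree → Set
  RootLe s t = root s ≤ root t

  insertByRoot-↭ : ∀ t us → insertByRoot t us ↭ t ∷ us
  insertByRoot-↭ t []       = ↭-refl
  insertByRoot-↭ t (u ∷ us) with root t ≤? root u
  ... | yes _ = ↭-refl
  ... | no  _ = ↭-trans (↭-prep u (insertByRoot-↭ t us)) (↭-swap u t ↭-refl)

  insertByRoot-sorted : ∀ t {us} → AllPairs RootLe us → AllPairs RootLe (insertByRoot t us)
  insertByRoot-sorted t {[]}     []       = [] ∷ []
  insertByRoot-sorted t {u ∷ us} (r ∷ rs) with root t ≤? root u
  ... | yes t≤u = (t≤u ∷ All.map (ℕₚ.≤-trans t≤u) r) ∷ r ∷ rs
  ... | no  t≰u =
    All-resp-↭ (↭-sym (insertByRoot-↭ t us)) (ℕₚ.<⇒≤ (ℕₚ.≰⇒> t≰u) ∷ r) ∷ insertByRoot-sorted t rs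

  sortByRoot-↭ : ∀ xs → sortByRoot xs ↭ xs
  sortByRoot-↭ []       = ↭-refl
  sortByRoot-↭ (x ∷ xs) = ↭-trans (insertByRoot-↭ x (sortByRoot xs)) (↭-prep x (sortByRoot-↭ xs))

  sortByRoot-weaklySorted : ∀ xs → AllPairs RootLe (sortByRoot xs)
  sortByRoot-weaklySorted []       = []
  sortByRoot-weaklySorted (x ∷ xs) = insertByRoot-sorted x (sortByRoot-weaklySorted xs)

  strictly-sorted : ∀ {ts} → AllPairs RootLe ts → Unique (map root ts) → Sorted ts
  strictly-sorted []                 _          = []
  strictly-sorted {t ∷ ts} (r ∷ rs) (t∉ ∷ u) = strict r t∉ ∷ strictly-sorted rs u
    where
    strict : ∀ {us} → All (RootLe t) us → All (root t ≢_) (map root us) → All (RootLt t) us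
    strict {[]}    []       []       = []
    strict {_ ∷ _} (p ∷ ps) (q ∷ qs) = ℕₚ.≤∧≢⇒< p q ∷ strict ps qs

-- A forest f on [n+1]
-- arises from exactly one forest g on [n], say with i trees: shift the labels
-- of g up by one, choose an arrangement (s , r) of i - j of the shifted trees,
-- make s the ordered children of a new root 1 and keep the other j trees r.
-- Then f = node 1 s ∷ r has j + 1 trees, and there are i P (i - j) choices.
module ForestRecursion where
  open Nat using (_+_)
  open ListFacts
  open Arrangements
  open Forests

  attach : List Tree × List Tree → List Tree
  attach (s , r) = node 1 s ∷ r

  attach-injective : ∀ {p q} → attach p ≡ attach q → p ≡ q
  attach-injective refl = refl

  newRootChoices : ℕ → ℕ → List Tree → List (List Tree × List Tree)
  newRootChoices i zero    h = []
  newRootChoices i (suc j) h with j ≤? i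
  ... | yes _ = arrangements (i ∸ j) h
  ... | no  _ = []

  newRootChoices-∈ : ∀ i k h {q} → q ∈ newRootChoices i k h →
    ∃ λ j → k ≡ suc j × j ≤ i × q ∈ arrangements (i ∸ j) h
  newRootChoices-∈ i (suc j) h q∈ with j ≤? i
  ... | yes j≤i = j , refl , j≤i , q∈

  newRootChoices-intro : ∀ i j h {q} → j ≤ i → q ∈ arrangements (i ∸ j) h → q ∈ newRootChoices i (suc j) h
  newRootChoices-intro i j h j≤i q∈ with j ≤? i
  ... | yes _   = q∈
  ... | no  j≰i = ⊥-elim (j≰i j≤i)

  newRootChoices-unique : ∀ i k {h} → Unique h → Unique (newRootChoices i k h)
  newRootChoices-unique i zero    u = []
  newRootChoices-unique i (suc j) u with j ≤? i
  ... | yes _ = arrangements-unique (i ∸ j) u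
  ... | no  _ = []

  range-suc : ∀ n → [ suc n ] ≡ 1 ∷ map suc [ n ]
  range-suc n = cong (1 ∷_) (sym (map-applyUpTo suc suc n))

  range-unique : ∀ n → Unique [ n ]
  range-unique n = Unique.applyUpTo⁺₁ suc n (λ i<j _ e → ℕₚ.<-irrefl (ℕₚ.suc-injective e) i<j)

  range-positive : ∀ n → All (1 ≤_) [ n ]
  range-positive n = All.applyUpTo⁺₂ suc n (λ _ → s≤s z≤n)

  ValidForest⇒length≤ : ∀ {n k g} → ValidForest n k g → k ≤ n
  ValidForest⇒length≤ {n} {g = g} (_ , lab , _ , refl) =
    ℕₚ.≤-trans (length≤labels g) (ℕₚ.≤-reflexive (trans (↭-length lab) (length-applyUpTo suc n)))

  labels-positive : ∀ {n k g} → ValidForest n k g → All (1 ≤_) (labelsF g)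
  labels-positive {n} (_ , lab , _ , _) = All-resp-↭ (↭-sym lab) (range-positive n)

  roots-positive : ∀ {n k g} → ValidForest n k g → All (λ t → 0 < root t) g
  roots-positive {g = g} v = All.map⁻ (All.tabulate λ x∈ → All.lookup (labels-positive v) (roots⊆labels g x∈))

  attach-valid : ∀ {n i j g s r} → ValidForest n i g → j ≤ i →
    (s , r) ∈ arrangements (i ∸ j) (shiftForest g) →
    ValidForest (suc n) (suc j) (attach (s , r)) × length s + length r ≡ i
  attach-valid {n} {i} {j} {g} {s} {r} vg@(inc , lab , linked , len) j≤i sr∈ =
    (increasing , labels↭ , sorted , cong suc length-r) , length-sr
    where
    s++r↭ : s ++ r ↭ shiftForest g
    s++r↭ = proj₂ (arrangement-↭ (i ∸ j) sr∈)
    roots>1 : All (λ t → 1 < root t) (s ++ r)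
    roots>1 = All-resp-↭ (↭-sym s++r↭) (shift-roots> g (roots-positive vg))
    increasing-s++r : All Increasing (s ++ r)
    increasing-s++r = All-resp-↭ (↭-sym s++r↭) (IncreasingF⇒All (IncreasingF-shift g inc))
    increasing : IncreasingF (attach (s , r))
    increasing = (All.++⁻ˡ s roots>1 , All⇒IncreasingF (All.++⁻ˡ s increasing-s++r))
               , All⇒IncreasingF (All.++⁻ʳ s increasing-s++r)
    labels↭ : labelsF (attach (s , r)) ↭ [ suc n ]
    labels↭ = subst (labelsF (attach (s , r)) ↭_) (sym (range-suc n)) (↭-prep 1 (subst (_↭ _) (labelsF-++ s r)
      (↭-trans (labelsF-↭ s++r↭) (subst (_↭ _) (sym (labelsF-shift g)) (map⁺ suc lab)))))
    sorted : Linked _<_ (map root (attach (s , r)))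
    sorted = Sorted⇒Linked {attach (s , r)}
      (All.++⁻ʳ s roots>1 ∷ arrangement-AllPairs (i ∸ j) sr∈ (Sorted-shift (Linked⇒Sorted linked)))
    length-sr : length s + length r ≡ i
    length-sr = trans (sym (length-++ s)) (trans (↭-length s++r↭) (trans (length-shift g) len))
    length-r : length r ≡ j
    length-r = trans (sym (ℕₚ.m+n∸m≡n (length s) (length r)))
                     (trans (cong₂ _∸_ length-sr (proj₁ (arrangement-↭ (i ∸ j) sr∈))) (ℕₚ.m∸[m∸n]≡n j≤i))

  root-is-one : ∀ {n k a s r} → ValidForest (suc n) k (node a s ∷ r) → a ≡ 1
  root-is-one {n} {a = a} {s} {r} v@(inc , lab , linked , _) =
    ℕₚ.≤-antisym a≤1 (All.lookup (labels-positive v) (here refl))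
    where
    a≤1 : a ≤ 1
    a≤1 with ∈-++⁻ (labels (node a s)) (∈-resp-↭ (↭-sym lab) (here refl))
    ... | inj₁ 1∈first = All.lookup (root-minimal (node a s) (proj₁ inc)) 1∈first
    ... | inj₂ 1∈rest with labelsF-∈ r 1∈rest
    ... | u , u∈r , 1∈u = ℕₚ.<⇒≤ (ℕₚ.<-≤-trans (All.lookup (Sorted-head (Linked⇒Sorted {node a s ∷ r} linked)) u∈r)
                            (All.lookup (root-minimal u (All.lookup (IncreasingF⇒All (proj₂ inc)) u∈r)) 1∈u))

  map-pred-suc : ∀ xs → map pred (map suc xs) ≡ xs
  map-pred-suc xs = trans (sym (map-∘ xs)) (map-id xs)

  predecessor : List Tree → List Tree → List Tree
  predecessor s r = unshiftForest (sortByRoot (s ++ r))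

  -- Completeness: removing the root 1 is inverse to the construction.
  predecessor-valid : ∀ {n k s r} → ValidForest (suc n) k (attach (s , r)) →
    ValidForest n (length s + length r) (predecessor s r)
    × (s , r) ∈ arrangements (length s) (shiftForest (predecessor s r))
  predecessor-valid {n} {k} {s} {r} (inc , lab , linked , _) =
    (increasing , labels↭ , Sorted⇒Linked (Sorted-unshift (subst Sorted (sym shift-g) sorted-h)) , length-g)
    , subst (λ h → (s , r) ∈ arrangements (length s) h) (sym shift-g)
        (arrangements-complete sorted-unique s (↭-sym (sortByRoot-↭ (s ++ r))) sorted-h
          (Sorted-tail (Linked⇒Sorted {attach (s , r)} linked)))
    where
    h g : List Tree
    h = sortByRoot (s ++ r)
    g = predecessor s r
    labels-h : labelsF h ↭ map suc [ n ]
    labels-h = ↭-trans (labelsF-↭ (sortByRoot-↭ (s ++ r)))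
                 (subst (_↭ _) (sym (labelsF-++ s r)) (drop-∷ (subst (labelsF (attach (s , r)) ↭_) (range-suc n) lab)))
    sorted-h : Sorted h
    sorted-h = strictly-sorted (sortByRoot-weaklySorted (s ++ r))
      (roots-unique h (unique-↭ (↭-sym labels-h) (Unique.map⁺ ℕₚ.suc-injective (range-unique n))))
    shift-g : shiftForest g ≡ h
    shift-g = shift-unshiftForest h
      (All-resp-↭ (↭-sym labels-h) (All.map⁺ (All.map (λ _ → s≤s z≤n) (range-positive n))))
    increasing : IncreasingF g
    increasing = IncreasingF-unshift g (subst IncreasingF (sym shift-g) (All⇒IncreasingF
      (All-resp-↭ (↭-sym (sortByRoot-↭ (s ++ r)))
        (All.++⁺ (IncreasingF⇒All (proj₂ (proj₁ inc))) (IncreasingF⇒All (proj₂ inc))))))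
    labels↭ : labelsF g ↭ [ n ]
    labels↭ = subst₂ _↭_ (map-pred-suc (labelsF g)) (map-pred-suc [ n ])
      (map⁺ pred (subst (_↭ _) (trans (cong labelsF (sym shift-g)) (labelsF-shift g)) labels-h))
    length-g : length g ≡ length s + length r
    length-g = trans (sym (length-shift g))
      (trans (cong length shift-g) (trans (↭-length (sortByRoot-↭ (s ++ r))) (length-++ s)))

  attach-complete : ∀ {n k f} → ValidForest (suc n) k f →
    ∃ λ i → i < suc n × ∃ λ g → ValidForest n i g × f ∈ map attach (newRootChoices i k (shiftForest g))
  attach-complete {f = []} (_ , lab , _) with ↭-length lab
  ... | ()
  attach-complete {n} {f = node a s ∷ r} v@(_ , _ , _ , refl) with root-is-one v
  ... | refl =
    length s + length r , s≤s (ValidForest⇒length≤ vg) , predecessor s r , vg ,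
    ∈-map⁺ attach (newRootChoices-intro (length s + length r) (length r) h (ℕₚ.m≤n+m _ _)
      (subst (λ d → (s , r) ∈ arrangements d h) (sym (ℕₚ.m+n∸n≡m (length s) (length r))) arranged))
    where
    h : List Tree
    h = shiftForest (predecessor s r)
    vg : ValidForest n (length s + length r) (predecessor s r)
    vg = proj₁ (predecessor-valid v)
    arranged : (s , r) ∈ arrangements (length s) h
    arranged = proj₂ (predecessor-valid v)

module Enumeration (enum : ℕ → ℕ → List (List Tree)) (isEnum : IsForestEnum enum) where
  open Nat using (_+_)
  open ListFacts
  open Arrangements
  open Forests
  open ForestRecursion

  enum-sound : ∀ {n k f} → f ∈ enum n k → ValidForest n k f
  enum-sound {n} {k} {f} = Equivalence.to (proj₂ (isEnum n k) f)

  enum-complete : ∀ {n k f} → ValidForest n k f → f ∈ enum n k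
  enum-complete {n} {k} {f} = Equivalence.from (proj₂ (isEnum n k) f)

  extensionsOf : ℕ → ℕ → ℕ → List (List Tree)
  extensionsOf n k i = concatMap (λ g → map attach (newRootChoices i k (shiftForest g))) (enum n i)

  extensions : ℕ → ℕ → ℕ → List (List Tree)
  extensions n k zero    = []
  extensions n k (suc M) = extensions n k M ++ extensionsOf n k M

  -- the number of trees of the forest an extension came from
  sourceSize : List Tree → ℕ
  sourceSize []             = 0
  sourceSize (node _ s ∷ r) = length s + length r

  extensionsOf-sound : ∀ n k i {f} → f ∈ extensionsOf n k i → ValidForest (suc n) k f × sourceSize f ≡ i
  extensionsOf-sound n k i f∈ with ∈-concatMap-elim _ (enum n i) f∈
  ... | g , g∈ , f∈′ with ∈-map⁻ attach f∈′
  ... | _ , q∈ , refl with newRootChoices-∈ i k (shiftForest g) q∈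
  ... | j , refl , j≤i , q∈′ = attach-valid (enum-sound g∈) j≤i q∈′

  extensions-sound : ∀ n k M {f} → f ∈ extensions n k M → ValidForest (suc n) k f × sourceSize f < M
  extensions-sound n k (suc M) f∈ with ∈-++⁻ (extensions n k M) f∈
  ... | inj₁ p = let (v , lt) = extensions-sound n k M p in v , ℕₚ.m<n⇒m<1+n lt
  ... | inj₂ p = let (v , eq) = extensionsOf-sound n k M p in v , s≤s (ℕₚ.≤-reflexive eq)

  enum-length : ∀ {n i g} → g ∈ enum n i → length g ≡ i
  enum-length g∈ with enum-sound g∈
  ... | _ , _ , _ , len = len

  enum-shift-sorted : ∀ {n i g} → g ∈ enum n i → Sorted (shiftForest g)
  enum-shift-sorted g∈ with enum-sound g∈
  ... | _ , _ , linked , _ = Sorted-shift (Linked⇒Sorted linked)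

  extensions-disjoint : ∀ {n k i g g′ f} → g ∈ enum n i → g′ ∈ enum n i →
    f ∈ map attach (newRootChoices i k (shiftForest g)) →
    f ∈ map attach (newRootChoices i k (shiftForest g′)) → g ≡ g′
  extensions-disjoint {k = k} {i} {g} {g′} g∈ g′∈ f∈ f∈′ with ∈-map⁻ attach f∈ | ∈-map⁻ attach f∈′
  ... | _ , q∈ , refl | _ , q∈′ , e with attach-injective e
  ... | refl with newRootChoices-∈ i k (shiftForest g) q∈ | newRootChoices-∈ i k (shiftForest g′) q∈′
  ... | j , refl , _ , a∈ | j′ , refl , _ , a∈′ =
    shiftForest-injective (sorted-unique
      (↭-trans (↭-sym (proj₂ (arrangement-↭ (i ∸ j) a∈))) (proj₂ (arrangement-↭ (i ∸ j′) a∈′)))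
      (enum-shift-sorted g∈) (enum-shift-sorted g′∈))

  extensions-unique : ∀ n k M → Unique (extensions n k M)
  extensions-unique n k zero    = []
  extensions-unique n k (suc M) =
    Unique.++⁺ (extensions-unique n k M)
      (concatMap-unique _ (enum n M) (proj₁ (isEnum n M))
        (λ g∈ → Unique.map⁺ attach-injective (newRootChoices-unique M k (Sorted⇒Unique (enum-shift-sorted g∈))))
        (extensions-disjoint {k = k}))
      λ (f∈old , f∈new) → ℕₚ.<-irrefl (proj₂ (extensionsOf-sound n k M f∈new)) (proj₂ (extensions-sound n k M f∈old))

  extensionsOf⊆extensions : ∀ n k i M {f} → i < M → f ∈ extensionsOf n k i → f ∈ extensions n k M
  extensionsOf⊆extensions n k i (suc M) i<1+M f∈ with i ℕₚ.≟ M
  ... | yes refl = ∈-++⁺ʳ (extensions n k M) f∈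
  ... | no  i≢M  = ∈-++⁺ˡ (extensionsOf⊆extensions n k i M (ℕₚ.≤∧≢⇒< (ℕₚ.≤-pred i<1+M) i≢M) f∈)

  -- every forest on [n+1] is produced (its source has at most n trees)
  extensions-complete : ∀ n k {f} → ValidForest (suc n) k f → f ∈ extensions n k (suc n)
  extensions-complete n k v with attach-complete v
  ... | i , i<1+n , g , vg , f∈ =
    extensionsOf⊆extensions n k i (suc n) i<1+n (∈-concatMap-intro _ (enum-complete vg) f∈)

  enum-suc : ∀ n k → enum (suc n) k ↭ extensions n k (suc n)
  enum-suc n k = same-members-↭ (proj₁ (isEnum (suc n) k)) (extensions-unique n k (suc n))
    (λ f∈ → extensions-complete n k (enum-sound f∈))
    (λ f∈ → enum-complete (proj₁ (extensions-sound n k (suc n) f∈)))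

  emptyForest : ℕ → List (List Tree)
  emptyForest zero    = [] ∷ []
  emptyForest (suc k) = []

  enum-zero : ∀ k → enum 0 k ↭ emptyForest k
  enum-zero k = same-members-↭ (proj₁ (isEnum 0 k)) (unique k)
    (λ f∈ → complete k (enum-sound f∈)) (λ f∈ → enum-complete (sound k f∈))
    where
    unique : ∀ k → Unique (emptyForest k)
    unique zero    = [] ∷ []
    unique (suc k) = []
    sound : ∀ k {f} → f ∈ emptyForest k → ValidForest 0 k f
    sound zero (here refl) = tt , ↭-refl , Linked.[] , refl
    complete : ∀ k {f} → ValidForest 0 k f → f ∈ emptyForest k
    complete k {[]}    (_ , _ , _ , refl) = here refl
    complete k {t ∷ f} v@(_ , _ , _ , refl) with ValidForest⇒length≤ v
    ... | ()

module FiniteSums {c ℓ : Level} (R : CommutativeRing c ℓ) where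
  open CommutativeRing R hiding (zero) renaming (refl to ≈-refl; sym to ≈-sym; trans to ≈-trans)
  open WithRing R
  open import Relation.Binary.Reasoning.Setoid setoid
  open Solver commutativeSemiring using (solve; _:+_; _:*_; _:=_)

  fromℕ-+ : ∀ m n → fromℕ (m Nat.+ n) ≈ fromℕ m + fromℕ n
  fromℕ-+ zero    n = ≈-sym (+-identityˡ _)
  fromℕ-+ (suc m) n = ≈-trans (+-congˡ (fromℕ-+ m n)) (≈-sym (+-assoc _ _ _))

  fromℕ-* : ∀ m n → fromℕ (m Nat.* n) ≈ fromℕ m * fromℕ n
  fromℕ-* zero    n = ≈-sym (zeroˡ _)
  fromℕ-* (suc m) n = begin
    fromℕ (n Nat.+ m Nat.* n)    ≈⟨ fromℕ-+ n (m Nat.* n) ⟩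
    fromℕ n + fromℕ (m Nat.* n)  ≈⟨ +-cong (≈-sym (*-identityˡ _)) (fromℕ-* m n) ⟩
    1# * fromℕ n + fromℕ m * fromℕ n ≈⟨ ≈-sym (distribʳ _ _ _) ⟩
    (1# + fromℕ m) * fromℕ n     ∎

  sumTo-cong : ∀ M {f g : ℕ → Carrier} → (∀ i → i < M → f i ≈ g i) → sumTo M f ≈ sumTo M g
  sumTo-cong zero    _ = ≈-refl
  sumTo-cong (suc M) h = +-cong (sumTo-cong M (λ i i<M → h i (ℕₚ.m<n⇒m<1+n i<M))) (h M ℕₚ.≤-refl)

  sumTo-zero : ∀ M {f : ℕ → Carrier} → (∀ i → i < M → f i ≈ 0#) → sumTo M f ≈ 0#
  sumTo-zero zero    _ = ≈-refl
  sumTo-zero (suc M) h =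
    ≈-trans (+-cong (sumTo-zero M (λ i i<M → h i (ℕₚ.m<n⇒m<1+n i<M))) (h M ℕₚ.≤-refl)) (+-identityʳ _)

  sumTo-+ : ∀ M (f g : ℕ → Carrier) → sumTo M (λ i → f i + g i) ≈ sumTo M f + sumTo M g
  sumTo-+ zero    f g = ≈-sym (+-identityˡ _)
  sumTo-+ (suc M) f g = ≈-trans (+-congʳ (sumTo-+ M f g))
    (solve 4 (λ a b x y → (a :+ b) :+ (x :+ y) := (a :+ x) :+ (b :+ y)) ≈-refl _ _ _ _)

  sumTo-*ˡ : ∀ M d (f : ℕ → Carrier) → sumTo M (λ i → d * f i) ≈ d * sumTo M f
  sumTo-*ˡ zero    d f = ≈-sym (zeroʳ _)
  sumTo-*ˡ (suc M) d f = ≈-trans (+-congʳ (sumTo-*ˡ M d f)) (≈-sym (distribˡ _ _ _))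

  sumTo-*ʳ : ∀ M d (f : ℕ → Carrier) → sumTo M (λ i → f i * d) ≈ sumTo M f * d
  sumTo-*ʳ zero    d f = ≈-sym (zeroˡ _)
  sumTo-*ʳ (suc M) d f = ≈-trans (+-congʳ (sumTo-*ʳ M d f)) (≈-sym (distribʳ _ _ _))

  sumTo-truncate : ∀ K N {f : ℕ → Carrier} → K ≤ N → (∀ i → K ≤ i → f i ≈ 0#) → sumTo N f ≈ sumTo K f
  sumTo-truncate K zero    z≤n _ = ≈-refl
  sumTo-truncate K (suc N) K≤1+N h with K ≤? N
  ... | yes K≤N = ≈-trans (+-cong (sumTo-truncate K N K≤N h) (h N K≤N)) (+-identityʳ _)
  ... | no  K≰N with ℕₚ.≤-antisym K≤1+N (ℕₚ.≰⇒> K≰N)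
  ... | refl = ≈-refl

  sumTo-bounds : ∀ K N M {f : ℕ → Carrier} → K ≤ N → K ≤ M → (∀ i → K ≤ i → f i ≈ 0#) →
    sumTo N f ≈ sumTo M f
  sumTo-bounds K N M K≤N K≤M h = ≈-trans (sumTo-truncate K N K≤N h) (≈-sym (sumTo-truncate K M K≤M h))

  sumTo-swap : ∀ M N (f : ℕ → ℕ → Carrier) →
    sumTo M (λ i → sumTo N (λ j → f i j)) ≈ sumTo N (λ j → sumTo M (λ i → f i j))
  sumTo-swap zero    N f = ≈-sym (sumTo-zero N (λ _ _ → ≈-refl))
  sumTo-swap (suc M) N f =
    ≈-trans (+-congʳ (sumTo-swap M N f)) (≈-sym (sumTo-+ N (λ j → sumTo M (λ i → f i j)) (f M)))

  sumTo-head : ∀ M (f : ℕ → Carrier) → sumTo (suc M) f ≈ f 0 + sumTo M (λ i → f (suc i))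
  sumTo-head zero    f = ≈-trans (+-identityˡ _) (≈-sym (+-identityʳ _))
  sumTo-head (suc M) f = ≈-trans (+-congʳ (sumTo-head M f)) (+-assoc _ _ _)

  sumTo-drop : ∀ j N (f : ℕ → Carrier) → (∀ i → i < j → f i ≈ 0#) →
    sumTo (j Nat.+ N) f ≈ sumTo N (λ a → f (j Nat.+ a))
  sumTo-drop zero    N f _ = ≈-refl
  sumTo-drop (suc j) N f h = begin
    sumTo (suc (j Nat.+ N)) f                  ≈⟨ sumTo-head (j Nat.+ N) f ⟩
    f 0 + sumTo (j Nat.+ N) (λ i → f (suc i))
      ≈⟨ +-cong (h 0 (s≤s z≤n)) (sumTo-drop j N (λ i → f (suc i)) (λ i i<j → h (suc i) (s≤s i<j))) ⟩
    0# + sumTo N (λ a → f (suc (j Nat.+ a)))   ≈⟨ +-identityˡ _ ⟩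
    sumTo N (λ a → f (suc j Nat.+ a))          ∎

  sumTo-reverse : ∀ N (f : ℕ → Carrier) → sumTo N f ≈ sumTo N (λ a → f (N ∸ suc a))
  sumTo-reverse zero    f = ≈-refl
  sumTo-reverse (suc N) f = begin
    sumTo N f + f N                       ≈⟨ +-comm _ _ ⟩
    f N + sumTo N f                       ≈⟨ +-congˡ (sumTo-reverse N f) ⟩
    f N + sumTo N (λ a → f (N ∸ suc a))   ≈⟨ ≈-sym (sumTo-head N (λ a → f (suc N ∸ suc a))) ⟩
    sumTo (suc N) (λ a → f (suc N ∸ suc a)) ∎

  δ-comm : ∀ i j → δ i j ≡ δ j i
  δ-comm zero    zero    = refl
  δ-comm zero    (suc j) = refl
  δ-comm (suc i) zero    = refl
  δ-comm (suc i) (suc j) = δ-comm i j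

  δ-off : ∀ i j → i ≢ j → δ i j ≡ 0#
  δ-off zero    zero    i≢j = ⊥-elim (i≢j refl)
  δ-off zero    (suc j) _   = refl
  δ-off (suc i) zero    _   = refl
  δ-off (suc i) (suc j) i≢j = δ-off i j (λ e → i≢j (cong suc e))

  δ-diag : ∀ i → δ i i ≡ 1#
  δ-diag zero    = refl
  δ-diag (suc i) = δ-diag i

  off-diagonal : ∀ (f : ℕ → Carrier) l j → l ≢ j → f l * δ l j ≈ 0#
  off-diagonal f l j l≢j = ≈-trans (*-congˡ (reflexive (δ-off l j l≢j))) (zeroʳ _)

  sumTo-δ : ∀ N (f : ℕ → Carrier) j → (N ≤ j → f j ≈ 0#) → sumTo N (λ l → f l * δ l j) ≈ f j
  sumTo-δ zero    f j h = ≈-sym (h z≤n)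
  sumTo-δ (suc N) f j h with N ℕₚ.≟ j
  ... | yes refl = ≈-trans (+-cong (sumTo-zero N (λ l l<N → off-diagonal f l j (λ e → ℕₚ.<-irrefl e l<N)))
                                   (≈-trans (*-congˡ (reflexive (δ-diag N))) (*-identityʳ _)))
                           (+-identityˡ _)
  ... | no  N≢j  = ≈-trans (+-cong (sumTo-δ N f j (λ N≤j → h (ℕₚ.≤∧≢⇒< N≤j N≢j))) (off-diagonal f N j N≢j))
                           (+-identityʳ _)

  sumL : ∀ {A : Set} → (A → Carrier) → List A → Carrier
  sumL w xs = sumList (map w xs)

  sumL-++ : ∀ {A : Set} (w : A → Carrier) xs ys → sumL w (xs ++ ys) ≈ sumL w xs + sumL w ys
  sumL-++ w []       ys = ≈-sym (+-identityˡ _)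
  sumL-++ w (x ∷ xs) ys = ≈-trans (+-congˡ (sumL-++ w xs ys)) (≈-sym (+-assoc _ _ _))

  sumL-↭ : ∀ {A : Set} (w : A → Carrier) {xs ys} → xs ↭ ys → sumL w xs ≈ sumL w ys
  sumL-↭ w Perm.refl         = ≈-refl
  sumL-↭ w (Perm.prep x p)   = +-congˡ (sumL-↭ w p)
  sumL-↭ w (Perm.swap x y p) =
    ≈-trans (≈-sym (+-assoc _ _ _)) (≈-trans (+-cong (+-comm _ _) (sumL-↭ w p)) (+-assoc _ _ _))
  sumL-↭ w (Perm.trans p q)  = ≈-trans (sumL-↭ w p) (sumL-↭ w q)

  sumL-concatMap : ∀ {A B : Set} (w : B → Carrier) (f : A → List B) xs →
    sumL w (concatMap f xs) ≈ sumL (λ x → sumL w (f x)) xs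
  sumL-concatMap w f []       = ≈-refl
  sumL-concatMap w f (x ∷ xs) = ≈-trans (sumL-++ w (f x) _) (+-congˡ (sumL-concatMap w f xs))

  sumL-map : ∀ {A B : Set} (w : B → Carrier) (f : A → B) xs → sumL w (map f xs) ≈ sumL (λ x → w (f x)) xs
  sumL-map w f []       = ≈-refl
  sumL-map w f (x ∷ xs) = +-congˡ (sumL-map w f xs)

  sumL-cong : ∀ {A : Set} (w v : A → Carrier) xs → (∀ {x} → x ∈ xs → w x ≈ v x) → sumL w xs ≈ sumL v xs
  sumL-cong w v []       _ = ≈-refl
  sumL-cong w v (x ∷ xs) h = +-cong (h (here refl)) (sumL-cong w v xs (λ p → h (there p)))

  sumL-constant : ∀ {A : Set} (w : A → Carrier) xs d → (∀ {x} → x ∈ xs → w x ≈ d) →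
    sumL w xs ≈ fromℕ (length xs) * d
  sumL-constant w []       d _ = ≈-sym (zeroˡ d)
  sumL-constant w (x ∷ xs) d h = begin
    w x + sumL w xs                       ≈⟨ +-cong (h (here refl)) (sumL-constant w xs d (λ p → h (there p))) ⟩
    d + fromℕ (length xs) * d             ≈⟨ +-congʳ (≈-sym (*-identityˡ d)) ⟩
    1# * d + fromℕ (length xs) * d        ≈⟨ ≈-sym (distribʳ d 1# _) ⟩
    (1# + fromℕ (length xs)) * d          ∎

  sumL-*ʳ : ∀ {A : Set} (w : A → Carrier) xs d → sumL (λ x → w x * d) xs ≈ sumL w xs * d
  sumL-*ʳ w []       d = ≈-sym (zeroˡ d)
  sumL-*ʳ w (x ∷ xs) d = ≈-trans (+-congˡ (sumL-*ʳ w xs d)) (≈-sym (distribʳ d _ _))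

-- Attaching the ordered children s to the new root multiplies the
-- weight by φ_{|s|}, and a shifted forest with i trees has i P (i-j)
-- arrangements of length i - j; hence
--   L_{n+1,j+1} = Σ_{i ≤ n} L_{n,i} · (i P (i-j)) φ_{i-j} = Σ_i L_{n,i} P_{i,j+1},
-- which together with L_{0,k} = δ_{0k} says that P is the production matrix.
module LahProduction {c ℓ : Level} (R : CommutativeRing c ℓ) (φ : ℕ → CommutativeRing.Carrier R)
    (enum : ℕ → ℕ → List (List Tree)) (isEnum : IsForestEnum enum) where
  open CommutativeRing R hiding (zero) renaming (refl to ≈-refl; sym to ≈-sym; trans to ≈-trans)
  open WithRing R
  open Weights φ
  open FiniteSums R
  open import Relation.Binary.Reasoning.Setoid setoid
  open Solver commutativeSemiring using (solve; _:*_; _:=_)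
  open Combinatorics using (_P_)
  open Arrangements
  open Forests
  open ForestRecursion
  open Enumeration enum isEnum

  weightF-++ : ∀ xs ys → weightF (xs ++ ys) ≈ weightF xs * weightF ys
  weightF-++ []       ys = ≈-sym (*-identityˡ _)
  weightF-++ (x ∷ xs) ys = ≈-trans (*-congˡ (weightF-++ xs ys)) (≈-sym (*-assoc _ _ _))

  weightF-↭ : ∀ {xs ys} → xs ↭ ys → weightF xs ≈ weightF ys
  weightF-↭ Perm.refl         = ≈-refl
  weightF-↭ (Perm.prep x p)   = *-congˡ (weightF-↭ p)
  weightF-↭ (Perm.swap x y p) =
    ≈-trans (≈-sym (*-assoc _ _ _)) (≈-trans (*-cong (*-comm _ _) (weightF-↭ p)) (*-assoc _ _ _))
  weightF-↭ (Perm.trans p q)  = ≈-trans (weightF-↭ p) (weightF-↭ q)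

  -- relabelling does not change degrees, hence not the weight
  mutual
    weight-shift : ∀ t → weight (shiftTree t) ≡ weight t
    weight-shift (node a ts) = cong₂ _*_ (cong φ (length-shift ts)) (weightF-shift ts)

    weightF-shift : ∀ ts → weightF (shiftForest ts) ≡ weightF ts
    weightF-shift []       = refl
    weightF-shift (t ∷ ts) = cong₂ _*_ (weight-shift t) (weightF-shift ts)

  attach-weight : ∀ d g {s r} → (s , r) ∈ arrangements d (shiftForest g) →
    weightF (attach (s , r)) ≈ φ d * weightF g
  attach-weight d g {s} {r} sr∈ = begin
    (φ (length s) * weightF s) * weightF r ≈⟨ *-assoc _ _ _ ⟩
    φ (length s) * (weightF s * weightF r) ≈⟨ *-cong (reflexive (cong φ length-s)) (≈-sym (weightF-++ s r)) ⟩
    φ d * weightF (s ++ r)                 ≈⟨ *-congˡ (≈-trans (weightF-↭ s++r↭) (reflexive (weightF-shift g))) ⟩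
    φ d * weightF g                        ∎
    where
    length-s : length s ≡ d
    length-s = proj₁ (arrangement-↭ d sr∈)
    s++r↭ : s ++ r ↭ shiftForest g
    s++r↭ = proj₂ (arrangement-↭ d sr∈)

  extensions-weight : ∀ i k g → length g ≡ i →
    sumL weightF (map attach (newRootChoices i k (shiftForest g))) ≈ weightF g * Pmat φ i k
  extensions-weight i zero    g _ = ≈-sym (zeroʳ _)
  extensions-weight i (suc j) g length-g with j ≤? i
  ... | no  _ = ≈-sym (zeroʳ _)
  ... | yes _ = begin
    sumL weightF (map attach (arrangements d h))        ≈⟨ sumL-map weightF attach (arrangements d h) ⟩
    sumL (λ q → weightF (attach q)) (arrangements d h)  ≈⟨ sumL-constant _ _ _ (attach-weight d g) ⟩
    fromℕ (length (arrangements d h)) * (φ d * weightF g)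
      ≈⟨ *-congʳ (reflexive (cong fromℕ (trans (arrangements-length d h) (cong (_P d) length-h)))) ⟩
    fromℕ (i P d) * (φ d * weightF g)
      ≈⟨ solve 3 (λ a b c → a :* (b :* c) := c :* (a :* b)) ≈-refl (fromℕ (i P d)) (φ d) (weightF g) ⟩
    weightF g * (fromℕ (i P d) * φ d)                   ∎
    where
    d : ℕ
    d = i ∸ j
    h : List Tree
    h = shiftForest g
    length-h : length h ≡ i
    length-h = trans (length-shift g) length-g

  extensionsOf-sum : ∀ n k i → sumL weightF (extensionsOf n k i) ≈ Lah enum n i * Pmat φ i k
  extensionsOf-sum n k i = begin
    sumL weightF (extensionsOf n k i)
      ≈⟨ sumL-concatMap weightF (λ g → map attach (newRootChoices i k (shiftForest g))) (enum n i) ⟩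
    sumL (λ g → sumL weightF (map attach (newRootChoices i k (shiftForest g)))) (enum n i)
      ≈⟨ sumL-cong _ _ (enum n i) (λ g∈ → extensions-weight i k _ (enum-length g∈)) ⟩
    sumL (λ g → weightF g * Pmat φ i k) (enum n i)
      ≈⟨ sumL-*ʳ weightF (enum n i) _ ⟩
    Lah enum n i * Pmat φ i k ∎

  extensions-sum : ∀ n k M → sumL weightF (extensions n k M) ≈ sumTo M (λ i → Lah enum n i * Pmat φ i k)
  extensions-sum n k zero    = ≈-refl
  extensions-sum n k (suc M) =
    ≈-trans (sumL-++ weightF (extensions n k M) (extensionsOf n k M))
            (+-cong (extensions-sum n k M) (extensionsOf-sum n k M))

  lah-production : ∀ n k → Lah enum n k ≈ 𝒪 (Pmat φ) n k
  lah-production zero    k = ≈-trans (sumL-↭ weightF (enum-zero k)) (empty k)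
    where
    empty : ∀ k → sumL weightF (emptyForest k) ≈ δ zero k
    empty zero    = +-identityʳ _
    empty (suc k) = ≈-refl
  lah-production (suc n) k = begin
    Lah enum (suc n) k                               ≈⟨ sumL-↭ weightF (enum-suc n k) ⟩
    sumL weightF (extensions n k (suc n))            ≈⟨ extensions-sum n k (suc n) ⟩
    sumTo (suc n) (λ i → Lah enum n i * Pmat φ i k)
      ≈⟨ sumTo-cong (suc n) (λ i _ → *-congʳ (lah-production n i)) ⟩
    𝒪 (Pmat φ) (suc n) k                              ∎

-- Products of infinite matrices with finitely many entries right of the
-- diagonal.  `Banded A s` says A_{ik} = 0 for k > s + i; lower-Hessenberg
-- matrices are banded with s = 1, lower-triangular ones with s = 0.  For such
-- matrices the truncated product ⊙ of the statement is the genuine product,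
-- so it is associative and the usual identities hold.
module BandedMatrices {c ℓ : Level} (R : CommutativeRing c ℓ) where
  open CommutativeRing R hiding (zero) renaming (refl to ≈-refl; sym to ≈-sym; trans to ≈-trans)
  open WithRing R
  open FiniteSums R
  open import Relation.Binary.Reasoning.Setoid setoid

  Banded : Matrix → ℕ → Set ℓ
  Banded A s = ∀ i k → s Nat.+ i < k → A i k ≈ 0#

  outside-band : ∀ {A s} → Banded A s → ∀ i k x → s Nat.+ i < k → A i k * x ≈ 0#
  outside-band band-A i k x s+i<k = ≈-trans (*-congʳ (band-A i k s+i<k)) (zeroˡ x)

  ⊙-as-sum : ∀ (A B : Matrix) s → Banded A s → s ≤ 1 → ∀ i j N → s Nat.+ i < N →
    (A ⊙ B) i j ≈ sumTo N (λ k → A i k * B k j)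
  ⊙-as-sum A B s band-A s≤1 i j N s+i<N =
    sumTo-bounds (suc (s Nat.+ i)) (suc (suc i)) N (s≤s (ℕₚ.+-monoˡ-≤ i s≤1)) s+i<N
      (λ k → outside-band band-A i k (B k j))

  ⊙-assoc : ∀ (A B C : Matrix) s t → Banded A s → Banded B t → s Nat.+ t ≤ 1 →
    ((A ⊙ B) ⊙ C) ≈ᴹ (A ⊙ (B ⊙ C))
  ⊙-assoc A B C s t band-A band-B s+t≤1 i j = begin
    sumTo K (λ k → sumTo K (λ l → A i l * B l k) * C k j)
      ≈⟨ sumTo-cong K (λ k _ → ≈-sym (sumTo-*ʳ K (C k j) (λ l → A i l * B l k))) ⟩
    sumTo K (λ k → sumTo K (λ l → A i l * B l k * C k j))
      ≈⟨ sumTo-swap K K _ ⟩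
    sumTo K (λ l → sumTo K (λ k → A i l * B l k * C k j))
      ≈⟨ sumTo-cong K (λ l _ → ≈-trans (sumTo-cong K (λ k _ → *-assoc _ _ _)) (sumTo-*ˡ K (A i l) _)) ⟩
    sumTo K (λ l → A i l * sumTo K (λ k → B l k * C k j))
      ≈⟨ sumTo-cong K inner ⟩
    sumTo K (λ l → A i l * (B ⊙ C) l j) ∎
    where
    K : ℕ
    K = suc (suc i)
    t≤1 : t ≤ 1
    t≤1 = ℕₚ.≤-trans (ℕₚ.m≤n+m t s) s+t≤1
    -- where A_{il} may be nonzero (l ≤ s + i), row l of B lies inside the range K
    inner : ∀ l → l < K → A i l * sumTo K (λ k → B l k * C k j) ≈ A i l * (B ⊙ C) l j
    inner l _ with l ≤? s Nat.+ i
    ... | no  l≰s+i = ≈-trans (outside-band band-A i l _ (ℕₚ.≰⇒> l≰s+i))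
                              (≈-sym (outside-band band-A i l _ (ℕₚ.≰⇒> l≰s+i)))
    ... | yes l≤s+i = *-congˡ (≈-sym (⊙-as-sum B C t band-B t≤1 l j K (s≤s t+l≤1+i)))
      where
      t+l≤1+i : t Nat.+ l ≤ suc i
      t+l≤1+i = ℕₚ.≤-trans (ℕₚ.+-monoʳ-≤ t l≤s+i)
        (subst (_≤ suc i) (ℕₚ.+-assoc t s i) (ℕₚ.+-monoˡ-≤ i (subst (_≤ 1) (ℕₚ.+-comm s t) s+t≤1)))

  ⊙-congˡ : ∀ {A B} (C : Matrix) → A ≈ᴹ B → (A ⊙ C) ≈ᴹ (B ⊙ C)
  ⊙-congˡ C A≈B i j = sumTo-cong (suc (suc i)) (λ k _ → *-congʳ (A≈B i k))

  ⊙-congʳ : ∀ (A : Matrix) {B C} → B ≈ᴹ C → (A ⊙ B) ≈ᴹ (A ⊙ C)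
  ⊙-congʳ A B≈C i j = sumTo-cong (suc (suc i)) (λ k _ → *-congˡ (B≈C k j))

  I⊙ : ∀ (A : Matrix) → (Iᴹ ⊙ A) ≈ᴹ A
  I⊙ A i j = ≈-trans
    (sumTo-cong (suc (suc i)) (λ k _ → ≈-trans (*-comm _ _) (*-congˡ (reflexive (δ-comm i k)))))
    (sumTo-δ (suc (suc i)) (λ k → A k j) i (λ 2+i≤i → ⊥-elim (ℕₚ.<-irrefl refl (ℕₚ.≤-trans (ℕₚ.n≤1+n _) 2+i≤i))))

  conjugation : ∀ (A H B Q : Matrix) → Banded A 0 → Banded H 1 → Banded B 0 →
    (A ⊙ B) ≈ᴹ Iᴹ → (H ⊙ B) ≈ᴹ (B ⊙ Q) → ((A ⊙ H) ⊙ B) ≈ᴹ Q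
  conjugation A H B Q band-A band-H band-B AB≈I HB≈BQ i j = begin
    ((A ⊙ H) ⊙ B) i j ≈⟨ ⊙-assoc A H B 0 1 band-A band-H ℕₚ.≤-refl i j ⟩
    (A ⊙ (H ⊙ B)) i j ≈⟨ ⊙-congʳ A HB≈BQ i j ⟩
    (A ⊙ (B ⊙ Q)) i j ≈⟨ ≈-sym (⊙-assoc A B Q 0 0 band-A band-B z≤n i j) ⟩
    ((A ⊙ B) ⊙ Q) i j ≈⟨ ⊙-congˡ Q AB≈I i j ⟩
    (Iᴹ ⊙ Q) i j      ≈⟨ I⊙ Q i j ⟩
    Q i j             ∎

  rowProduct : ℕ → (ℕ → Carrier) → Matrix → ℕ → Carrier
  rowProduct N v A k = sumTo N (λ j → v j * A j k)

  rowProduct-assoc : ∀ N M (v : ℕ → Carrier) (A C : Matrix) k →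
    rowProduct N (rowProduct M v A) C k ≈ rowProduct M v (λ j k → sumTo N (λ i → A j i * C i k)) k
  rowProduct-assoc N M v A C k = begin
    sumTo N (λ i → sumTo M (λ j → v j * A j i) * C i k)
      ≈⟨ sumTo-cong N (λ i _ → ≈-sym (sumTo-*ʳ M (C i k) _)) ⟩
    sumTo N (λ i → sumTo M (λ j → v j * A j i * C i k))  ≈⟨ sumTo-swap N M _ ⟩
    sumTo M (λ j → sumTo N (λ i → v j * A j i * C i k))
      ≈⟨ sumTo-cong M (λ j _ → ≈-trans (sumTo-cong N (λ i _ → *-assoc _ _ _)) (sumTo-*ˡ N (v j) _)) ⟩
    sumTo M (λ j → v j * sumTo N (λ i → A j i * C i k))  ∎

  𝒪-banded : ∀ (H : Matrix) → Banded H 1 → Banded (𝒪 H) 0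
  𝒪-banded H band-H zero    (suc j) _ = ≈-refl
  𝒪-banded H band-H (suc n) j 1+n<j = sumTo-zero (suc n) λ i i<1+n →
    ≈-trans (*-congˡ (band-H i j (ℕₚ.≤-<-trans i<1+n 1+n<j))) (zeroʳ _)

  output-transfer : ∀ (H B Q : Matrix) → Banded H 1 → Banded B 0 → (∀ k → B 0 k ≈ δ 0 k) →
    (H ⊙ B) ≈ᴹ (B ⊙ Q) → ∀ n k → 𝒪 Q n k ≈ rowProduct (suc n) (𝒪 H n) B k
  output-transfer H B Q band-H band-B B-row0 HB≈BQ zero k = ≈-sym (begin
    0# + 1# * B 0 k ≈⟨ +-identityˡ _ ⟩
    1# * B 0 k      ≈⟨ *-identityˡ _ ⟩
    B 0 k           ≈⟨ B-row0 k ⟩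
    δ 0 k           ∎)
  output-transfer H B Q band-H band-B B-row0 HB≈BQ (suc n) k = begin
    rowProduct (suc n) (𝒪 Q n) Q k
      ≈⟨ sumTo-cong (suc n) (λ i _ → *-congʳ (output-transfer H B Q band-H band-B B-row0 HB≈BQ n i)) ⟩
    rowProduct (suc n) (rowProduct (suc n) O B) Q k
      ≈⟨ rowProduct-assoc (suc n) (suc n) O B Q k ⟩
    rowProduct (suc n) O (λ j k → sumTo (suc n) (λ i → B j i * Q i k)) k
      ≈⟨ sumTo-cong (suc n) (λ j j<1+n → *-congˡ
           (≈-trans (≈-sym (⊙-as-sum B Q 0 band-B z≤n j k (suc n) j<1+n)) (≈-sym (HB≈BQ j k)))) ⟩
    rowProduct (suc n) O (H ⊙ B) k
      ≈⟨ sumTo-cong (suc n) (λ j j<1+n → *-congˡ (⊙-as-sum H B 1 band-H ℕₚ.≤-refl j k (suc (suc n)) (s≤s j<1+n))) ⟩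
    rowProduct (suc n) O (λ j k → sumTo (suc (suc n)) (λ l → H j l * B l k)) k
      ≈⟨ ≈-sym (rowProduct-assoc (suc (suc n)) (suc n) O H B k) ⟩
    rowProduct (suc (suc n)) (𝒪 H (suc n)) B k ∎
    where
    O : ℕ → Carrier
    O = 𝒪 H n

  output-product : ∀ (H B Q : Matrix) → Banded H 1 → Banded B 0 → (∀ k → B 0 k ≈ δ 0 k) →
    (H ⊙ B) ≈ᴹ (B ⊙ Q) → ∀ n k M → n < M → rowProduct M (𝒪 H n) B k ≈ 𝒪 Q n k
  output-product H B Q band-H band-B B-row0 HB≈BQ n k M n<M =
    ≈-trans (sumTo-truncate (suc n) M n<M
              (λ j n<j → outside-band (𝒪-banded H band-H) n j (B j k) n<j))
            (≈-sym (output-transfer H B Q band-H band-B B-row0 HB≈BQ n k))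

-- The binomial matrices (B_a)_{nk} = C(n,k) a^{n-k} form a one-parameter
-- group: B_a B_b = B_{a+b} and B_0 = I, so B_{-y} is the inverse of B_y.
-- The product formula is proved by induction on the row, using the Pascal
-- recurrence (B_a)_{i+1,k+1} = (B_a)_{ik} + a (B_a)_{i,k+1}.
module BinomialMatrices {c ℓ : Level} (R : CommutativeRing c ℓ) where
  open CommutativeRing R hiding (zero) renaming (refl to ≈-refl; sym to ≈-sym; trans to ≈-trans)
  open WithRing R
  open FiniteSums R
  open BandedMatrices R
  open import Relation.Binary.Reasoning.Setoid setoid
  open Solver commutativeSemiring using (solve; _:+_; _:*_; _:=_)
  open Combinatorics using (_C_; nCk+nC[k+1]≡[n+1]C[k+1]; nCk≡nC[n∸k]; nCn≡1; k>n⇒nCk≡0)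

  nC0≡1 : ∀ n → n C 0 ≡ 1
  nC0≡1 n = trans (nCk≡nC[n∸k] {n = n} z≤n) (nCn≡1 n)

  ∸-suc : ∀ {k i} → k < i → i ∸ k ≡ suc (i ∸ suc k)
  ∸-suc {zero}  {suc i} _         = refl
  ∸-suc {suc k} {suc i} (s≤s k<i) = ∸-suc k<i

  pow-cong : ∀ {a b} n → a ≈ b → pow a n ≈ pow b n
  pow-cong zero    _   = ≈-refl
  pow-cong (suc n) a≈b = *-cong a≈b (pow-cong n a≈b)

  B-banded : ∀ a → Banded (Bmat a) 0
  B-banded a i k i<k = ≈-trans (*-congʳ (reflexive (cong fromℕ (k>n⇒nCk≡0 i<k)))) (zeroˡ _)

  B-row0 : ∀ a k → Bmat a 0 k ≈ δ 0 k
  B-row0 a zero    = ≈-trans (*-identityʳ _) (+-identityʳ _)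
  B-row0 a (suc k) = zeroˡ _

  B-column0 : ∀ a i → Bmat a (suc i) 0 ≈ a * Bmat a i 0
  B-column0 a i = begin
    fromℕ (suc i C 0) * (a * pow a i) ≈⟨ *-congʳ (reflexive (cong fromℕ (trans (nC0≡1 (suc i)) (sym (nC0≡1 i))))) ⟩
    fromℕ (i C 0) * (a * pow a i)     ≈⟨ solve 3 (λ c a p → c :* (a :* p) := a :* (c :* p)) ≈-refl _ a _ ⟩
    a * (fromℕ (i C 0) * pow a i)     ∎

  B-pascal : ∀ a i k → Bmat a (suc i) (suc k) ≈ Bmat a i k + a * Bmat a i (suc k)
  B-pascal a i k = begin
    fromℕ (suc i C suc k) * pow a (i ∸ k)
      ≈⟨ *-congʳ (reflexive (cong fromℕ (sym (nCk+nC[k+1]≡[n+1]C[k+1] i k)))) ⟩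
    fromℕ (i C k Nat.+ i C suc k) * pow a (i ∸ k)
      ≈⟨ ≈-trans (*-congʳ (fromℕ-+ (i C k) (i C suc k))) (distribʳ _ _ _) ⟩
    fromℕ (i C k) * pow a (i ∸ k) + fromℕ (i C suc k) * pow a (i ∸ k)
      ≈⟨ +-congˡ (second-term (suc k ≤? i)) ⟩
    fromℕ (i C k) * pow a (i ∸ k) + a * (fromℕ (i C suc k) * pow a (i ∸ suc k)) ∎
    where
    second-term : Dec (suc k ≤ i) →
      fromℕ (i C suc k) * pow a (i ∸ k) ≈ a * (fromℕ (i C suc k) * pow a (i ∸ suc k))
    second-term (yes k<i) = ≈-trans (*-congˡ (reflexive (cong (pow a) (∸-suc k<i))))
      (solve 3 (λ c a p → c :* (a :* p) := a :* (c :* p)) ≈-refl _ a _)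
    second-term (no k≮i) = ≈-trans (*-congʳ C≈0) (≈-trans (zeroˡ _)
      (≈-sym (≈-trans (*-congˡ (≈-trans (*-congʳ C≈0) (zeroˡ _))) (zeroʳ _))))
      where
      C≈0 : fromℕ (i C suc k) ≈ 0#
      C≈0 = reflexive (cong fromℕ (k>n⇒nCk≡0 (ℕₚ.≰⇒> k≮i)))

  B-product : ∀ a b i j N → i < N → sumTo N (λ k → Bmat a i k * Bmat b k j) ≈ Bmat (a + b) i j
  B-product a b zero j N 0<N = begin
    sumTo N (λ k → Bmat a 0 k * Bmat b k j)
      ≈⟨ sumTo-truncate 1 N 0<N (λ k → outside-band (B-banded a) 0 k (Bmat b k j)) ⟩
    0# + Bmat a 0 0 * Bmat b 0 j    ≈⟨ +-identityˡ _ ⟩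
    Bmat a 0 0 * Bmat b 0 j         ≈⟨ *-cong (B-row0 a 0) (B-row0 b j) ⟩
    1# * δ 0 j                      ≈⟨ *-identityˡ _ ⟩
    δ 0 j                           ≈⟨ ≈-sym (B-row0 (a + b) j) ⟩
    Bmat (a + b) 0 j                ∎
  B-product a b (suc i) j (suc N) (s≤s i<N) =
    ≈-trans (peel-row j) (shifted-sum j)
    where
    Ba Bb Bab : Matrix
    Ba = Bmat a
    Bb = Bmat b
    Bab = Bmat (a + b)
    X : ℕ → Carrier
    X j = sumTo N (λ k → Ba i k * Bb (suc k) j)
    -- expand row i+1 of B_a by the Pascal recurrence and use the hypothesis for row i
    peel-row : ∀ j → sumTo (suc N) (λ k → Ba (suc i) k * Bb k j) ≈ X j + a * Bab i j
    peel-row j = begin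
      sumTo (suc N) (λ k → Ba (suc i) k * Bb k j) ≈⟨ sumTo-head N _ ⟩
      Ba (suc i) 0 * Bb 0 j + sumTo N (λ k → Ba (suc i) (suc k) * Bb (suc k) j)
        ≈⟨ +-cong (≈-trans (*-congʳ (B-column0 a i)) (*-assoc _ _ _))
                  (sumTo-cong N (λ k _ → ≈-trans (*-congʳ (B-pascal a i k)) (distribʳ _ _ _))) ⟩
      a * (Ba i 0 * Bb 0 j) + sumTo N (λ k → Ba i k * Bb (suc k) j + a * Ba i (suc k) * Bb (suc k) j)
        ≈⟨ +-congˡ (≈-trans (sumTo-+ N _ _) (+-congˡ (≈-trans (sumTo-cong N (λ k _ → *-assoc _ _ _)) (sumTo-*ˡ N a _)))) ⟩
      a * (Ba i 0 * Bb 0 j) + (X j + a * sumTo N (λ k → Ba i (suc k) * Bb (suc k) j))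
        ≈⟨ solve 4 (λ a z x y → a :* z :+ (x :+ a :* y) := x :+ a :* (z :+ y)) ≈-refl a _ (X j) _ ⟩
      X j + a * (Ba i 0 * Bb 0 j + sumTo N (λ k → Ba i (suc k) * Bb (suc k) j))
        ≈⟨ +-congˡ (*-congˡ (≈-trans (≈-sym (sumTo-head N (λ k → Ba i k * Bb k j)))
                                     (B-product a b i j (suc N) (ℕₚ.m<n⇒m<1+n i<N)))) ⟩
      X j + a * Bab i j ∎
    -- expand B_b by the Pascal recurrence and use the hypothesis for row i again
    shifted-sum : ∀ j → X j + a * Bab i j ≈ Bab (suc i) j
    shifted-sum zero = begin
      X 0 + a * Bab i 0
        ≈⟨ +-congʳ (≈-trans (sumTo-cong N (λ k _ → ≈-trans (*-congˡ (B-column0 b k))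
                                         (solve 3 (λ x b y → x :* (b :* y) := b :* (x :* y)) ≈-refl _ b _)))
                     (≈-trans (sumTo-*ˡ N b _) (*-congˡ (B-product a b i 0 N i<N)))) ⟩
      b * Bab i 0 + a * Bab i 0 ≈⟨ solve 3 (λ a b z → b :* z :+ a :* z := (a :+ b) :* z) ≈-refl a b _ ⟩
      (a + b) * Bab i 0         ≈⟨ ≈-sym (B-column0 (a + b) i) ⟩
      Bab (suc i) 0             ∎
    shifted-sum (suc j) = begin
      X (suc j) + a * Bab i (suc j)
        ≈⟨ +-congʳ (≈-trans (sumTo-cong N (λ k _ → ≈-trans (*-congˡ (B-pascal b k j)) (distribˡ _ _ _)))
             (≈-trans (sumTo-+ N _ _) (+-cong (B-product a b i j N i<N)
               (≈-trans (sumTo-cong N (λ k _ → solve 3 (λ x b y → x :* (b :* y) := b :* (x :* y)) ≈-refl _ b _))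
                 (≈-trans (sumTo-*ˡ N b _) (*-congˡ (B-product a b i (suc j) N i<N))))))) ⟩
      Bab i j + b * Bab i (suc j) + a * Bab i (suc j)
        ≈⟨ solve 4 (λ a b x z → x :+ b :* z :+ a :* z := x :+ (a :+ b) :* z) ≈-refl a b _ _ ⟩
      Bab i j + (a + b) * Bab i (suc j) ≈⟨ ≈-sym (B-pascal (a + b) i j) ⟩
      Bab (suc i) (suc j)               ∎

  B-zero : Bmat 0# ≈ᴹ Iᴹ
  B-zero i j with ℕₚ.<-cmp i j
  ... | tri< i<j _ _ = ≈-trans (B-banded 0# i j i<j)
                               (≈-sym (reflexive (δ-off i j (ℕₚ.<⇒≢ i<j))))
  ... | tri≈ _ refl _ = begin
    fromℕ (i C i) * pow 0# (i ∸ i) ≈⟨ *-cong (reflexive (cong fromℕ (nCn≡1 i))) (reflexive (cong (pow 0#) (ℕₚ.n∸n≡0 i))) ⟩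
    (1# + 0#) * 1#                 ≈⟨ ≈-trans (*-identityʳ _) (+-identityʳ _) ⟩
    1#                             ≈⟨ ≈-sym (reflexive (δ-diag i)) ⟩
    δ i i                          ∎
  ... | tri> _ _ j<i = ≈-trans (*-congˡ (≈-trans (reflexive (cong (pow 0#) (∸-suc j<i))) (zeroˡ _)))
                               (≈-trans (zeroʳ _) (≈-sym (reflexive (δ-off i j (λ e → ℕₚ.<⇒≢ j<i (sym e))))))

  B-inverse : ∀ a b → a + b ≈ 0# → (Bmat a ⊙ Bmat b) ≈ᴹ Iᴹ
  B-inverse a b a+b≈0 i j = begin
    (Bmat a ⊙ Bmat b) i j ≈⟨ B-product a b i j (suc (suc i)) (ℕₚ.m<n⇒m<1+n (ℕₚ.n<1+n i)) ⟩
    Bmat (a + b) i j      ≈⟨ *-congˡ (pow-cong (i ∸ j) a+b≈0) ⟩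
    Bmat 0# i j           ≈⟨ B-zero i j ⟩
    Iᴹ i j                ∎

-- The counting identity behind the similarity P B_y = B_y Q: for i = j + a + u,
--   (i P u) · C(j+a, j) = C(i, j+u) · ((j+u) P u),
-- both sides being i!/(j! a!).  It is checked after multiplying by j! a!.
module FactorialIdentity where
  open Nat using (_+_; _*_; _!)
  open Combinatorics using (_P_; _C_)
  open ℕₚ using ( _!≢0; *-cancelʳ-≡; *-assoc; *-comm; m*n≢0; +-assoc; +-comm
                ; m+n∸m≡n; m+n∸n≡m; m≤m+n; m≤n+m; +-monoʳ-≤; ≤-trans)
  open import Data.Nat.Solver using (module +-*-Solver)
  open +-*-Solver using (solve; _:*_; _:=_)

  P-factorial : ∀ {n k} → k ≤ n → (n P k) * (n ∸ k) ! ≡ n !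
  P-factorial {n} {k} k≤n = trans (cong (_* (n ∸ k) !) (nPk≡n!/[n∸k]! k≤n))
    (m/n*n≡m {{(n ∸ k) !≢0}} (∣-trans (m∣m*n (k !)) ([n∸k]!k!∣n! k≤n)))

  C-factorial : ∀ {n k} → k ≤ n → (n C k) * (k ! * (n ∸ k) !) ≡ n !
  C-factorial {n} {k} k≤n = trans (cong (_* (k ! * (n ∸ k) !)) (nCk≡n!/k![n-k]! k≤n))
    (m/n*n≡m {{m*n≢0 (k !) ((n ∸ k) !) {{k !≢0}} {{(n ∸ k) !≢0}}}}
      (subst (_∣ n !) (*-comm ((n ∸ k) !) (k !)) ([n∸k]!k!∣n! k≤n)))

  j+a+u∸[j+a] : ∀ j a u → j + (a + u) ∸ (j + a) ≡ u
  j+a+u∸[j+a] j a u = trans (cong (_∸ (j + a)) (sym (+-assoc j a u))) (m+n∸m≡n (j + a) u)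

  j+a+u∸[j+u] : ∀ j a u → j + (a + u) ∸ (j + u) ≡ a
  j+a+u∸[j+u] j a u = trans (cong (_∸ (j + u)) (trans (cong (j +_) (+-comm a u)) (sym (+-assoc j u a))))
                            (m+n∸m≡n (j + u) a)

  arrange-choose-swap : ∀ j a u →
    ((j + (a + u)) P u) * ((j + a) C j) ≡ ((j + (a + u)) C (j + u)) * ((j + u) P u)
  arrange-choose-swap j a u =
    *-cancelʳ-≡ _ _ (j ! * a !) {{m*n≢0 (j !) (a !) {{j !≢0}} {{a !≢0}}}} (trans left (sym right))
    where
    i : ℕ
    i = j + (a + u)
    i∸u : i ∸ u ≡ j + a
    i∸u = trans (cong (_∸ u) (sym (+-assoc j a u))) (m+n∸n≡m (j + a) u)
    choose : ((j + a) C j) * (j ! * a !) ≡ (j + a) !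
    choose = trans (cong (λ z → ((j + a) C j) * (j ! * z !)) (sym (m+n∸m≡n j a))) (C-factorial (m≤m+n j a))
    left : (i P u) * ((j + a) C j) * (j ! * a !) ≡ i !
    left = begin
      (i P u) * ((j + a) C j) * (j ! * a !)   ≡⟨ *-assoc (i P u) _ _ ⟩
      (i P u) * (((j + a) C j) * (j ! * a !)) ≡⟨ cong ((i P u) *_) choose ⟩
      (i P u) * (j + a) !                     ≡⟨ cong (λ z → (i P u) * z !) (sym i∸u) ⟩
      (i P u) * (i ∸ u) !                     ≡⟨ P-factorial (≤-trans (m≤n+m u a) (m≤n+m (a + u) j)) ⟩
      i !                                     ∎
      where open ≡-Reasoning
    right : (i C (j + u)) * ((j + u) P u) * (j ! * a !) ≡ i !
    right = begin
      (i C (j + u)) * ((j + u) P u) * (j ! * a !)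
        ≡⟨ solve 4 (λ c p x y → c :* p :* (x :* y) := c :* ((p :* x) :* y)) refl
                   (i C (j + u)) ((j + u) P u) (j !) (a !) ⟩
      (i C (j + u)) * (((j + u) P u) * j ! * a !)
        ≡⟨ cong (λ z → (i C (j + u)) * (((j + u) P u) * z ! * a !)) (sym (m+n∸n≡m j u)) ⟩
      (i C (j + u)) * (((j + u) P u) * ((j + u) ∸ u) ! * a !)
        ≡⟨ cong (λ z → (i C (j + u)) * (z * a !)) (P-factorial (m≤n+m u j)) ⟩
      (i C (j + u)) * ((j + u) ! * a !)
        ≡⟨ cong (λ z → (i C (j + u)) * ((j + u) ! * z !)) (sym (j+a+u∸[j+u] j a u)) ⟩
      (i C (j + u)) * ((j + u) ! * (i ∸ (j + u)) !)
        ≡⟨ C-factorial (+-monoʳ-≤ j (m≤n+m u a)) ⟩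
      i ! ∎
      where open ≡-Reasoning

-- Write P = T Δ, where T_{ik} = P_{i,k+1} = (i P (i-k)) φ_{i-k}
-- drops the zero first column.  The Pascal recurrence says Δ B = B (Δ + yI),
-- and ΔΔᵀ = I gives Q = P(I + yΔᵀ) = T(Δ + yI).  Hence P B = T B (Δ + yI) and
-- B Q = B T (Δ + yI), so P B = B Q follows from T B = B T, which in turn is
-- the counting identity of FactorialIdentity after reindexing the sums.
module ProductionMatrix {c ℓ : Level} (R : CommutativeRing c ℓ)
    (φ : ℕ → CommutativeRing.Carrier R) (y : CommutativeRing.Carrier R) where
  open CommutativeRing R hiding (zero) renaming (refl to ≈-refl; sym to ≈-sym; trans to ≈-trans)
  open WithRing R
  open FiniteSums R
  open BandedMatrices R
  open BinomialMatrices R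
  open FactorialIdentity using (arrange-choose-swap; j+a+u∸[j+a]; j+a+u∸[j+u])
  open Combinatorics using (_P_; _C_)
  open import Relation.Binary.Reasoning.Setoid setoid
  open Solver commutativeSemiring using (solve; con; _:+_; _:*_; _:=_)

  Pm Bm Q : Matrix
  Pm = Pmat φ
  Bm = Bmat y
  Q  = Pm ⊙ (Iᴹ +ᴹ (y ·ᴹ (Δ ᵀ)))

  P-banded : Banded Pm 1
  P-banded i (suc j) 1+i<1+j with j ≤? i
  ... | yes j≤i = ⊥-elim (ℕₚ.<-irrefl refl (ℕₚ.<-≤-trans (ℕₚ.≤-pred 1+i<1+j) j≤i))
  ... | no  _   = ≈-refl

  T : Matrix
  T i k = Pm i (suc k)

  T-value : ∀ i k → k ≤ i → T i k ≈ fromℕ (i P (i ∸ k)) * φ (i ∸ k)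
  T-value i k k≤i with k ≤? i
  ... | yes _   = ≈-refl
  ... | no  k≰i = ⊥-elim (k≰i k≤i)

  T-zero : ∀ i k → i < k → T i k ≈ 0#
  T-zero i k i<k with k ≤? i
  ... | yes k≤i = ⊥-elim (ℕₚ.<-irrefl refl (ℕₚ.<-≤-trans i<k k≤i))
  ... | no  _   = ≈-refl

  TB BT : Matrix
  TB i j = sumTo (suc i) (λ k → T i k * Bm k j)
  BT i j = sumTo (suc i) (λ m → Bm i m * T m j)

  -- the (j+a)-th term of (TB)_{ij} equals the (j+u)-th term of (BT)_{ij}, i = j+a+u:
  -- both are i!/(j! a!) φ_u y^a
  matching-terms : ∀ j e a u → e ≡ a Nat.+ u →
    T (j Nat.+ e) (j Nat.+ a) * Bm (j Nat.+ a) j ≈ Bm (j Nat.+ e) (j Nat.+ u) * T (j Nat.+ u) j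
  matching-terms j _ a u refl = begin
    T i (j Nat.+ a) * Bm (j Nat.+ a) j
      ≈⟨ *-cong (≈-trans (T-value i (j Nat.+ a) (ℕₚ.+-monoʳ-≤ j (ℕₚ.m≤m+n a u)))
                         (reflexive (cong (λ z → fromℕ (i P z) * φ z) (j+a+u∸[j+a] j a u))))
                (reflexive (cong (λ z → fromℕ ((j Nat.+ a) C j) * pow y z) (ℕₚ.m+n∸m≡n j a))) ⟩
    (fromℕ (i P u) * φ u) * (fromℕ ((j Nat.+ a) C j) * pow y a)
      ≈⟨ solve 4 (λ p f c w → (p :* f) :* (c :* w) := (p :* c) :* (f :* w)) ≈-refl _ _ _ _ ⟩
    (fromℕ (i P u) * fromℕ ((j Nat.+ a) C j)) * (φ u * pow y a)
      ≈⟨ *-congʳ (≈-trans (≈-sym (fromℕ-* (i P u) _))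
                 (≈-trans (reflexive (cong fromℕ (arrange-choose-swap j a u))) (fromℕ-* (i C (j Nat.+ u)) _))) ⟩
    (fromℕ (i C (j Nat.+ u)) * fromℕ ((j Nat.+ u) P u)) * (φ u * pow y a)
      ≈⟨ solve 4 (λ c p f w → (c :* p) :* (f :* w) := (c :* w) :* (p :* f)) ≈-refl _ _ _ _ ⟩
    (fromℕ (i C (j Nat.+ u)) * pow y a) * (fromℕ ((j Nat.+ u) P u) * φ u)
      ≈⟨ *-cong (reflexive (cong (λ z → fromℕ (i C (j Nat.+ u)) * pow y z) (sym (j+a+u∸[j+u] j a u))))
                (≈-sym (≈-trans (T-value (j Nat.+ u) j (ℕₚ.m≤m+n j u))
                                (reflexive (cong (λ z → fromℕ ((j Nat.+ u) P z) * φ z) (ℕₚ.m+n∸m≡n j u))))) ⟩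
    Bm i (j Nat.+ u) * T (j Nat.+ u) j ∎
    where
    i : ℕ
    i = j Nat.+ (a Nat.+ u)

  -- T B = B T: both sums run over a + u = e with e = i - j, in opposite directions
  TB≈BT-at : ∀ j e → TB (j Nat.+ e) j ≈ BT (j Nat.+ e) j
  TB≈BT-at j e = begin
    sumTo (suc (j Nat.+ e)) F      ≈⟨ reflexive (cong (λ z → sumTo z F) (sym (ℕₚ.+-suc j e))) ⟩
    sumTo (j Nat.+ suc e) F
      ≈⟨ sumTo-drop j (suc e) F (λ k k<j → ≈-trans (*-congˡ (B-banded y k j k<j)) (zeroʳ _)) ⟩
    sumTo (suc e) (λ a → F (j Nat.+ a))
      ≈⟨ sumTo-cong (suc e) (λ a a<1+e → matching-terms j e a (e ∸ a) (sym (ℕₚ.m+[n∸m]≡n (ℕₚ.≤-pred a<1+e)))) ⟩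
    sumTo (suc e) (λ a → G (j Nat.+ (e ∸ a))) ≈⟨ ≈-sym (sumTo-reverse (suc e) (λ a → G (j Nat.+ a))) ⟩
    sumTo (suc e) (λ a → G (j Nat.+ a))
      ≈⟨ ≈-sym (sumTo-drop j (suc e) G (λ m m<j → ≈-trans (*-congˡ (T-zero m j m<j)) (zeroʳ _))) ⟩
    sumTo (j Nat.+ suc e) G        ≈⟨ reflexive (cong (λ z → sumTo z G) (ℕₚ.+-suc j e)) ⟩
    sumTo (suc (j Nat.+ e)) G      ∎
    where
    F G : ℕ → Carrier
    F k = T (j Nat.+ e) k * Bm k j
    G m = Bm (j Nat.+ e) m * T m j

  TB≈BT : TB ≈ᴹ BT
  TB≈BT i j = by-cases (j ≤? i)
    where
    below : j ≰ i → ∀ {k} → k < suc i → k < j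
    below j≰i k≤i = ℕₚ.<-≤-trans k≤i (ℕₚ.≰⇒> j≰i)
    by-cases : Dec (j ≤ i) → TB i j ≈ BT i j
    by-cases (yes j≤i) = subst (λ z → TB z j ≈ BT z j) (ℕₚ.m+[n∸m]≡n j≤i) (TB≈BT-at j (i ∸ j))
    by-cases (no  j≰i) = ≈-trans
      (sumTo-zero (suc i) (λ k k≤i → ≈-trans (*-congˡ (B-banded y k j (below j≰i k≤i))) (zeroʳ _)))
      (≈-sym (sumTo-zero (suc i) (λ m m≤i → ≈-trans (*-congˡ (T-zero m j (below j≰i m≤i))) (zeroʳ _))))

  -- P B = T (Δ B) = T B (Δ + yI), by the Pascal recurrence of B
  PB-column0 : ∀ i → (Pm ⊙ Bm) i 0 ≈ y * TB i 0
  PB-column0 i = begin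
    sumTo (suc (suc i)) (λ k → Pm i k * Bm k 0)             ≈⟨ sumTo-head (suc i) _ ⟩
    0# * Bm 0 0 + sumTo (suc i) (λ k → T i k * Bm (suc k) 0)
      ≈⟨ ≈-trans (+-cong (zeroˡ _) (sumTo-cong (suc i) (λ k _ → *-congˡ (B-column0 y k)))) (+-identityˡ _) ⟩
    sumTo (suc i) (λ k → T i k * (y * Bm k 0))
      ≈⟨ sumTo-cong (suc i) (λ k _ → solve 3 (λ t y b → t :* (y :* b) := y :* (t :* b)) ≈-refl _ y _) ⟩
    sumTo (suc i) (λ k → y * (T i k * Bm k 0))              ≈⟨ sumTo-*ˡ (suc i) y _ ⟩
    y * TB i 0                                              ∎

  PB-column : ∀ i j → (Pm ⊙ Bm) i (suc j) ≈ TB i j + y * TB i (suc j)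
  PB-column i j = begin
    sumTo (suc (suc i)) (λ k → Pm i k * Bm k (suc j))        ≈⟨ sumTo-head (suc i) _ ⟩
    0# * Bm 0 (suc j) + sumTo (suc i) (λ k → T i k * Bm (suc k) (suc j))
      ≈⟨ ≈-trans (+-cong (zeroˡ _) (sumTo-cong (suc i) (λ k _ → *-congˡ (B-pascal y k j)))) (+-identityˡ _) ⟩
    sumTo (suc i) (λ k → T i k * (Bm k j + y * Bm k (suc j)))
      ≈⟨ sumTo-cong (suc i) (λ k _ → solve 4 (λ t b y c → t :* (b :+ y :* c) := t :* b :+ y :* (t :* c)) ≈-refl _ _ y _) ⟩
    sumTo (suc i) (λ k → T i k * Bm k j + y * (T i k * Bm k (suc j)))
      ≈⟨ ≈-trans (sumTo-+ (suc i) _ _) (+-congˡ (sumTo-*ˡ (suc i) y _)) ⟩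
    TB i j + y * TB i (suc j)                               ∎

  Q-entry : ∀ m j → Q m j ≈ Pm m j + y * Pm m (suc j)
  Q-entry m j = begin
    sumTo (suc (suc m)) (λ l → Pm m l * (δ l j + y * δ (suc j) l))
      ≈⟨ sumTo-cong (suc (suc m)) (λ l _ → ≈-trans (distribˡ _ _ _) (+-congˡ
           (≈-trans (solve 3 (λ p y d → p :* (y :* d) := y :* (p :* d)) ≈-refl _ y _)
                    (*-congˡ (*-congˡ (reflexive (δ-comm (suc j) l))))))) ⟩
    sumTo (suc (suc m)) (λ l → Pm m l * δ l j + y * (Pm m l * δ l (suc j)))
      ≈⟨ ≈-trans (sumTo-+ (suc (suc m)) _ _) (+-congˡ (sumTo-*ˡ (suc (suc m)) y _)) ⟩
    sumTo (suc (suc m)) (λ l → Pm m l * δ l j) + y * sumTo (suc (suc m)) (λ l → Pm m l * δ l (suc j))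
      ≈⟨ +-cong (sumTo-δ (suc (suc m)) (Pm m) j (beyond j))
                (*-congˡ (sumTo-δ (suc (suc m)) (Pm m) (suc j) (beyond (suc j)))) ⟩
    Pm m j + y * Pm m (suc j) ∎
    where
    beyond : ∀ k → suc (suc m) ≤ k → Pm m k ≈ 0#
    beyond k 2+m≤k = P-banded m k 2+m≤k

  BQ-entry : ∀ i j → (Bm ⊙ Q) i j ≈ sumTo (suc i) (λ m → Bm i m * (Pm m j + y * Pm m (suc j)))
  BQ-entry i j = ≈-trans (⊙-as-sum Bm Q 0 (B-banded y) z≤n i j (suc i) ℕₚ.≤-refl)
                         (sumTo-cong (suc i) (λ m _ → *-congˡ (Q-entry m j)))

  PB≈BQ : (Pm ⊙ Bm) ≈ᴹ (Bm ⊙ Q)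
  PB≈BQ i zero = begin
    (Pm ⊙ Bm) i 0                                  ≈⟨ PB-column0 i ⟩
    y * TB i 0                                     ≈⟨ *-congˡ (TB≈BT i 0) ⟩
    y * BT i 0                                     ≈⟨ ≈-sym (sumTo-*ˡ (suc i) y _) ⟩
    sumTo (suc i) (λ m → y * (Bm i m * T m 0))
      ≈⟨ sumTo-cong (suc i) (λ m _ → solve 3 (λ y b t → y :* (b :* t) := b :* (con 0 :+ y :* t)) ≈-refl y _ _) ⟩
    sumTo (suc i) (λ m → Bm i m * (0# + y * T m 0)) ≈⟨ ≈-sym (BQ-entry i 0) ⟩
    (Bm ⊙ Q) i 0                                   ∎
  PB≈BQ i (suc j) = begin
    (Pm ⊙ Bm) i (suc j)                            ≈⟨ PB-column i j ⟩
    TB i j + y * TB i (suc j)                      ≈⟨ +-cong (TB≈BT i j) (*-congˡ (TB≈BT i (suc j))) ⟩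
    BT i j + y * BT i (suc j)
      ≈⟨ ≈-trans (+-congˡ (≈-sym (sumTo-*ˡ (suc i) y _))) (≈-sym (sumTo-+ (suc i) _ _)) ⟩
    sumTo (suc i) (λ m → Bm i m * T m j + y * (Bm i m * T m (suc j)))
      ≈⟨ sumTo-cong (suc i) (λ m _ → solve 4 (λ b t y s → b :* t :+ y :* (b :* s) := b :* (t :+ y :* s)) ≈-refl _ _ y _) ⟩
    sumTo (suc i) (λ m → Bm i m * (T m j + y * T m (suc j))) ≈⟨ ≈-sym (BQ-entry i (suc j)) ⟩
    (Bm ⊙ Q) i (suc j)                             ∎

proposition1p4 : ∀ {c ℓ : Level} (R : CommutativeRing c ℓ) (φ : ℕ → CommutativeRing.Carrier R) (y : CommutativeRing.Carrier R)
    (enum : ℕ → ℕ → List (List Tree)) → IsForestEnum enum →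
    let open CommutativeRing R
        open WithRing R
        open Weights φ
        P = Pmat φ
        B = Bmat y
        Binv = Bmat (- y)
        Q = P ⊙ (Iᴹ +ᴹ (y ·ᴹ (Δ ᵀ)))
    in
    (∀ n k → Lah enum n k ≈ 𝒪 P n k)
    × ((Binv ⊙ B) ≈ᴹ Iᴹ) × ((B ⊙ Binv) ≈ᴹ Iᴹ)
    × (((Binv ⊙ P) ⊙ B) ≈ᴹ Q)
    × (∀ n k M → n < M → sumTo M (λ j → Lah enum n j * B j k) ≈ 𝒪 Q n k)
proposition1p4 R φ y enum isEnum =
  lah-production , left-inverse , B-inverse y (- y) (-‿inverseʳ y) ,
  conjugation (Bmat (- y)) Pm Bm Q (B-banded (- y)) P-banded (B-banded y) left-inverse PB≈BQ ,
  λ n k M n<M →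
    ≈-trans (sumTo-cong M (λ j _ → *-congʳ (lah-production n j)))
            (output-product Pm Bm Q P-banded (B-banded y) (B-row0 y) PB≈BQ n k M n<M)
  where
  open CommutativeRing R using (-_; -‿inverseˡ; -‿inverseʳ; *-congʳ) renaming (trans to ≈-trans)
  open WithRing R using (Bmat; Iᴹ; _⊙_; _≈ᴹ_)
  open FiniteSums R using (sumTo-cong)
  open BandedMatrices R using (conjugation; output-product)
  open BinomialMatrices R using (B-banded; B-row0; B-inverse)
  open ProductionMatrix R φ y using (Pm; Bm; Q; P-banded; PB≈BQ)
  open LahProduction R φ enum isEnum using (lah-production)

  left-inverse : (Bmat (- y) ⊙ Bmat y) ≈ᴹ Iᴹ
  left-inverse = B-inverse (- y) y (-‿inverseˡ y)
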